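{- Let $n\ge1$, $1\le m\le n$ and $1\le k_1<\dots<k_m\le 2n$. If $w\in\mathfrak{S}_{2n}$ is chosen uniformly at random, then the probability that all of the positions $w^{ -1}(k_1),\dots,w^{ -1}(k_m)$ belong to $\mathcal{A}(w)$ is \[\prod_{i=1}^m\frac{k_i-2i+1}{2n-2i+1}.\]
   Context: Crossout procedure: for $w\in\mathfrak{S}_{2n}$ in one-line notation $w(1)\cdots w(2n)$, repeat until all positions are marked: mark "B" at the unmarked position $i$ with smallest value $w(i)$, then mark "A" at the leftmost unmarked position. $\mathcal{A}(w)$ is the set of positions marked A (interpreted as the morsels eaten by Alice, where $w^{ -1}(k)$ is the morsel Alice ranks $k$th worst). -}

module Defs where

open import Data.Nat using (ℕ; zero; suc; _*_; _∸_; _⊓_; _!)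
open import Data.Nat.Properties using (_!≢0)
import Data.Nat as ℕ
open import Data.Fin using (Fin; toℕ)
import Data.Fin as Fin
open import Data.Fin.Properties using (all?; any?)
open import Data.List using (List; []; _∷_; [_]; map; concatMap; filter; length; foldr; zip; allFin)
import Data.List as List
open import Data.Vec using (Vec; lookup; toList)
import Data.Vec as Vec
open import Data.Product using (_×_; _,_; proj₁; proj₂; ∃)
open import Data.Integer using (ℤ; +_)
import Data.Integer as ℤ
open import Data.Rational using (ℚ; _/_; 1ℚ)
import Data.Rational as ℚ
open import Data.List.Membership.Propositional using (_∈_)
open import Data.List.Relation.Unary.Unique.Propositional using (Unique)
open import Relation.Binary.PropositionalEquality using (_≡_)
open import Relation.Nullary using (Dec; ¬?)
open import Relation.Nullary.Decidable using (_→-dec_)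

-- A word w = w(1)…w(N) is a Vec (Fin N) N (values 0-indexed: Fin value v
-- stands for the number v+1); it is a permutation iff its entries are
-- pairwise distinct.

words : (N len : ℕ) → List (Vec (Fin N) len)
words N zero      = [ Vec.[] ]
words N (suc len) = concatMap (λ x → map (x Vec.∷_) (words N len)) (allFin N)

unique? : ∀ {N} (xs : List (Fin N)) → Dec (Unique xs)
unique? {N} = U.unique?
  where import Data.List.Relation.Unary.Unique.DecPropositional (Fin._≟_ {n = N}) as U

perms : (N : ℕ) → List (Vec (Fin N) N)
perms N = filter (λ w → unique? (toList w)) (words N N)

-- Crossout procedure.
-- State: the list of unmarked positions, in increasing order of position,
-- each paired with its value w(i).

-- remove the unmarked entry of smallest value (marked "B");
-- values are pairwise distinct, so exactly one entry is removed
removeMin : ∀ {N} → List (Fin N × Fin N) → List (Fin N × Fin N)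
removeMin {N} l = filter (λ p → ¬? (toℕ (proj₂ p) ℕ.≟ mn)) l
  where mn = foldr (λ p r → toℕ (proj₂ p) ⊓ r) N l

-- r rounds of: mark B at the smallest unmarked value, then mark A at
-- the leftmost unmarked position.  Returns the positions marked A.
rounds : ∀ {N} → ℕ → List (Fin N × Fin N) → List (Fin N)
rounds zero    l = []
rounds (suc r) l with removeMin l
... | []            = []
... | (i , _) ∷ rest = i ∷ rounds r rest

𝒜 : ∀ n → Vec (Fin (2 * n)) (2 * n) → List (Fin (2 * n))
𝒜 n w = rounds n (zip (allFin (2 * n)) (toList w))

-- The event: every position w⁻¹(k_j) (j = 1..m) lies in 𝒜(w).
-- ks holds k_1,…,k_m as 1-indexed values, so position i is w⁻¹(k_j)
-- iff w(i) (1-indexed) = suc (toℕ (lookup w i)) equals k_j.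

Event : ∀ n {m} → Vec ℕ m → Vec (Fin (2 * n)) (2 * n) → Set
Event n {m} ks w =
  ∀ (i : Fin (2 * n)) →
    (∃ λ (j : Fin m) → suc (toℕ (lookup w i)) ≡ lookup ks j) → i ∈ 𝒜 n w

event? : ∀ n {m} (ks : Vec ℕ m) (w : Vec (Fin (2 * n)) (2 * n)) → Dec (Event n ks w)
event? n {m} ks w =
  all? (λ i → any? (λ j → suc (toℕ (lookup w i)) ℕ.≟ lookup ks j)
              →-dec M._∈?_ i (𝒜 n w))
  where import Data.List.Membership.DecPropositional (Fin._≟_ {n = 2 * n}) as M

prob : ∀ n {m} → Vec ℕ m → ℚ
prob n ks = (+ length (filter (event? n ks) (perms (2 * n)))) / ((2 * n) !)
  where instance _ = (2 * n) !≢0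

-- For index j : Fin m, i = toℕ j + 1, so
--   k_i − 2i + 1 = k_i − (2·toℕ j + 1)       (as an integer)
--   2n − 2i + 1 = suc (2n ∸ 2i)              (valid since i ≤ m ≤ n)
factor : ℕ → ℕ → ℕ → ℚ
factor n i k = (+ k ℤ.- + (2 * i ∸ 1)) / suc (2 * n ∸ 2 * i)

productFormula : ∀ n {m} → Vec ℕ m → ℚ
productFormula n {m} ks =
  foldr (λ j r → factor n (suc (toℕ j)) (lookup ks j) ℚ.* r) 1ℚ (allFin m)

module Submission where

-- Call the values k_j − 1 (0-indexed) special.  The event only depends on
-- the sequence of values: each round removes the smallest remaining value
-- (B) and then the first remaining letter (A), and the event says that no
-- special value is ever the smallest one (PositionCrossout, ValueCrossout).
-- Let count r S be the number of arrangements of a 2r-set S with this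
-- property.  Splitting on whether the first letter is min S, and using that
-- deleting a fixed letter from all arrangements of U hits every arrangement
-- of U∖{m} exactly |U| times (Arrangements), count r S depends only on the
-- special/ordinary pattern bs of S and obeys the recursion crossoutCount.
-- That recursion has the closed form
--   crossoutCount r bs = (2r)!! · ballot 0 bs · (2(r − #special) − 1)!!
-- (CrossoutCount), and for the pattern of the values 0 … 2n−1 the ballot
-- product is ∏_j (k_j − 2j + 1) (SpecialPattern).  The permutations of Defs
-- are the arrangements of Fin 2n (WordsAsArrangements), which gives the
-- number of favourable permutations (Favourable); dividing by
-- (2n)! = (2n)!! · (2n−1)!! yields the product formula (Factorials,
-- Fractions, Probability).

open import Data.Nat as ℕ using (ℕ; zero; suc; _∸_; _<_; _≤_; z≤n; s≤s; _≤?_; _⊓_)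
import Data.Nat.Properties as ℕP
import Data.Nat.Tactic.RingSolver as ℕSolver
open import Data.Integer as ℤ using (ℤ; +_; 0ℤ; 1ℤ)
import Data.Integer.Properties as ℤP
import Data.Integer.Tactic.RingSolver as ℤSolver
open import Data.Bool using (Bool; true; false; not; _∧_; if_then_else_)
open import Data.Fin as F using (Fin; toℕ)
import Data.Fin.Properties as FP
open import Data.List using (List; []; _∷_; length; map; concatMap; _++_; filter; foldr; allFin; zip; tabulate)
import Data.List.Properties as LP
open import Data.List.Membership.Propositional using (_∈_; _∉_)
import Data.List.Membership.Propositional.Properties as LMP
open import Data.List.Relation.Unary.Any using (here; there)
open import Data.List.Relation.Unary.All as All using (All; []; _∷_)
import Data.List.Relation.Unary.All.Properties as AllP
open import Data.List.Relation.Unary.AllPairs as AP using (AllPairs; []; _∷_)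
import Data.List.Relation.Unary.AllPairs.Properties as APP
open import Data.List.Relation.Unary.Unique.Propositional using (Unique)
open import Data.Vec as V using (Vec; lookup; toList)
import Data.Vec.Properties as VP
import Data.Vec.Membership.Propositional.Properties as VMP
import Data.Vec.Relation.Unary.Any as VAny
import Data.Vec.Relation.Unary.Any.Properties as VAnyP
open import Data.Product using (_×_; _,_; proj₁; proj₂; ∃)
open import Data.Sum using (inj₁; inj₂)
open import Data.Empty using (⊥; ⊥-elim)
open import Relation.Binary.PropositionalEquality
open import Relation.Nullary using (Dec; yes; no; does; ¬?)
open import Relation.Unary using (Decidable)
open import Function using (_∘_)

module Sums where

  ∑ : {A : Set} → List A → (A → ℕ) → ℕ
  ∑ []       f = 0
  ∑ (x ∷ xs) f = f x ℕ.+ ∑ xs f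

  𝟙 : Bool → ℕ
  𝟙 b = if b then 1 else 0

  𝟙-∧ : ∀ a b → 𝟙 (a ∧ b) ≡ 𝟙 a ℕ.* 𝟙 b
  𝟙-∧ true  b = sym (ℕP.+-identityʳ (𝟙 b))
  𝟙-∧ false b = refl

  ∑-++ : ∀ {A : Set} (xs ys : List A) f → ∑ (xs ++ ys) f ≡ ∑ xs f ℕ.+ ∑ ys f
  ∑-++ []       ys f = refl
  ∑-++ (x ∷ xs) ys f = trans (cong (f x ℕ.+_) (∑-++ xs ys f)) (sym (ℕP.+-assoc (f x) _ _))

  ∑-map : ∀ {A B : Set} (h : A → B) xs f → ∑ (map h xs) f ≡ ∑ xs (f ∘ h)
  ∑-map h []       f = refl
  ∑-map h (x ∷ xs) f = cong (f (h x) ℕ.+_) (∑-map h xs f)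

  ∑-concatMap : ∀ {A B : Set} (g : A → List B) xs f →
                ∑ (concatMap g xs) f ≡ ∑ xs (λ x → ∑ (g x) f)
  ∑-concatMap g []       f = refl
  ∑-concatMap g (x ∷ xs) f =
    trans (∑-++ (g x) (concatMap g xs) f) (cong (∑ (g x) f ℕ.+_) (∑-concatMap g xs f))

  ∑-cong∈ : ∀ {A : Set} (xs : List A) {f g} → (∀ x → x ∈ xs → f x ≡ g x) → ∑ xs f ≡ ∑ xs g
  ∑-cong∈ []       e = refl
  ∑-cong∈ (x ∷ xs) e = cong₂ ℕ._+_ (e x (here refl)) (∑-cong∈ xs (λ y y∈ → e y (there y∈)))

  ∑-cong : ∀ {A : Set} (xs : List A) {f g} → (∀ x → f x ≡ g x) → ∑ xs f ≡ ∑ xs g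
  ∑-cong xs e = ∑-cong∈ xs (λ x _ → e x)

  ∑-*ˡ : ∀ {A : Set} (xs : List A) c f → ∑ xs (λ x → c ℕ.* f x) ≡ c ℕ.* ∑ xs f
  ∑-*ˡ []       c f = sym (ℕP.*-zeroʳ c)
  ∑-*ˡ (x ∷ xs) c f =
    trans (cong (c ℕ.* f x ℕ.+_) (∑-*ˡ xs c f)) (sym (ℕP.*-distribˡ-+ c (f x) _))

  length-filter : ∀ {A : Set} {P : A → Set} (P? : ∀ x → Dec (P x)) xs →
                  length (filter P? xs) ≡ ∑ xs (𝟙 ∘ does ∘ P?)
  length-filter P? [] = refl
  length-filter P? (x ∷ xs) with does (P? x)
  ... | true  = cong suc (length-filter P? xs)
  ... | false = length-filter P? xs

  ∑-filter : ∀ {A : Set} {P : A → Set} (P? : ∀ x → Dec (P x)) xs f →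
             ∑ (filter P? xs) f ≡ ∑ xs (λ x → 𝟙 (does (P? x)) ℕ.* f x)
  ∑-filter P? [] f = refl
  ∑-filter P? (x ∷ xs) f with does (P? x)
  ... | true  = cong₂ ℕ._+_ (sym (ℕP.+-identityʳ (f x))) (∑-filter P? xs f)
  ... | false = ∑-filter P? xs f

open Sums

filter-comm : ∀ {A : Set} {P Q : A → Set} (P? : Decidable P) (Q? : Decidable Q) xs →
              filter P? (filter Q? xs) ≡ filter Q? (filter P? xs)
filter-comm P? Q? [] = refl
filter-comm P? Q? (x ∷ xs) with does (P? x) in p | does (Q? x) in q
... | true  | true  rewrite p | q = cong (x ∷_) (filter-comm P? Q? xs)
... | true  | false rewrite q     = filter-comm P? Q? xs
... | false | true  rewrite p     = filter-comm P? Q? xs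
... | false | false               = filter-comm P? Q? xs

witness : ∀ {A : Set} (d : Dec A) → does d ≡ true → A
witness (yes a) _ = a

does-≡ : ∀ {A : Set} (d : Dec A) (b : Bool) → (A → b ≡ true) → (b ≡ true → A) → does d ≡ b
does-≡ (yes a)  b     to from = sym (to a)
does-≡ (no ¬a) false to from = refl
does-≡ (no ¬a) true  to from = ⊥-elim (¬a (from refl))

∧-true⁻ : ∀ a b → a ∧ b ≡ true → a ≡ true × b ≡ true
∧-true⁻ true true _ = refl , refl

map-filter : ∀ {A B : Set} {P : B → Set} (f : A → B) (P? : Decidable P) xs →
             map f (filter (P? ∘ f) xs) ≡ filter P? (map f xs)
map-filter f P? [] = refl
map-filter f P? (x ∷ xs) with does (P? (f x))
... | true  = cong (f x ∷_) (map-filter f P? xs)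
... | false = map-filter f P? xs

-- A set of 2r values is abstracted to the list bs of its bits, listed by
-- increasing value: true for a special value, false for an ordinary one.
-- crossoutCount r bs counts (as shown in ValueCrossout) the arrangements of
-- such a set for which the r crossout rounds mark every special value A.

module CrossoutCount where
  open import Data.Integer using (_+_; _*_; _-_)

  ∑drop : (List Bool → ℕ) → List Bool → ℕ
  ∑drop g []       = 0
  ∑drop g (b ∷ bs) = g bs ℕ.+ ∑drop (g ∘ (b ∷_)) bs

  -- The smallest value is crossed out as B, so it must be ordinary; the A-mark
  -- then removes one of the other 2r+1 values, and the position of that value
  -- relative to the smallest one contributes the factor (2r+2).
  crossoutCount : ℕ → List Bool → ℕ
  crossoutCount zero    _            = 1
  crossoutCount (suc r) []           = 0
  crossoutCount (suc r) (true ∷ bs)  = 0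
  crossoutCount (suc r) (false ∷ bs) = suc (length bs) ℕ.* ∑drop (crossoutCount r) bs

  ∑dropF ∑dropT : (List Bool → ℤ) → List Bool → ℤ
  ∑dropF g []           = 0ℤ
  ∑dropF g (true ∷ bs)  = ∑dropF (g ∘ (true ∷_)) bs
  ∑dropF g (false ∷ bs) = g bs + ∑dropF (g ∘ (false ∷_)) bs
  ∑dropT g []           = 0ℤ
  ∑dropT g (true ∷ bs)  = g bs + ∑dropT (g ∘ (true ∷_)) bs
  ∑dropT g (false ∷ bs) = ∑dropT (g ∘ (false ∷_)) bs

  ballot : ℤ → List Bool → ℤ
  ballot d []           = 1ℤ
  ballot d (false ∷ bs) = ballot (d + 1ℤ) bs
  ballot d (true ∷ bs)  = d * ballot (d - 1ℤ) bs

  #T #F : List Bool → ℕ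
  #T []           = 0
  #T (true ∷ bs)  = suc (#T bs)
  #T (false ∷ bs) = #T bs
  #F []           = 0
  #F (true ∷ bs)  = #F bs
  #F (false ∷ bs) = suc (#F bs)

  excess : List Bool → ℤ
  excess []           = 0ℤ
  excess (true ∷ bs)  = excess bs - 1ℤ
  excess (false ∷ bs) = excess bs + 1ℤ

  oddFact evenFact : ℕ → ℕ
  oddFact zero     = 1
  oddFact (suc k)  = suc (k ℕ.+ k) ℕ.* oddFact k
  evenFact zero    = 1
  evenFact (suc r) = (2 ℕ.+ (r ℕ.+ r)) ℕ.* evenFact r

  closedForm : ℕ → List Bool → ℤ
  closedForm r bs = + evenFact r * (ballot 0ℤ bs * + oddFact (r ∸ #T bs))

  #F+#T : ∀ bs → #F bs ℕ.+ #T bs ≡ length bs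
  #F+#T []           = refl
  #F+#T (true ∷ bs)  = trans (ℕP.+-suc (#F bs) (#T bs)) (cong suc (#F+#T bs))
  #F+#T (false ∷ bs) = cong suc (#F+#T bs)

  excess≡#F-#T : ∀ bs → excess bs ≡ + #F bs - + #T bs
  excess≡#F-#T []           = refl
  excess≡#F-#T (true ∷ bs)  = trans (cong (_- 1ℤ) (excess≡#F-#T bs)) (ring (+ #F bs) (+ #T bs))
    where ring : ∀ f t → (f - t) - 1ℤ ≡ f - (1ℤ + t)
          ring = ℤSolver.solve-∀
  excess≡#F-#T (false ∷ bs) = trans (cong (_+ 1ℤ) (excess≡#F-#T bs)) (ring (+ #F bs) (+ #T bs))
    where ring : ∀ f t → (f - t) + 1ℤ ≡ (1ℤ + f) - t
          ring = ℤSolver.solve-∀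

  ∑dropF-cong : ∀ {g h} bs → (∀ x → suc (length x) ≡ length bs → g x ≡ h x) →
                ∑dropF g bs ≡ ∑dropF h bs
  ∑dropF-cong []           e = refl
  ∑dropF-cong (true ∷ bs)  e = ∑dropF-cong bs (λ x lx → e (true ∷ x) (cong suc lx))
  ∑dropF-cong (false ∷ bs) e =
    cong₂ _+_ (e bs refl) (∑dropF-cong bs (λ x lx → e (false ∷ x) (cong suc lx)))

  ∑dropT-cong : ∀ {g h} bs → (∀ x → suc (length x) ≡ length bs → g x ≡ h x) →
                ∑dropT g bs ≡ ∑dropT h bs
  ∑dropT-cong []           e = refl
  ∑dropT-cong (false ∷ bs) e = ∑dropT-cong bs (λ x lx → e (false ∷ x) (cong suc lx))
  ∑dropT-cong (true ∷ bs)  e =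
    cong₂ _+_ (e bs refl) (∑dropT-cong bs (λ x lx → e (true ∷ x) (cong suc lx)))

  ∑dropF-*ˡ : ∀ c g bs → ∑dropF (λ x → c * g x) bs ≡ c * ∑dropF g bs
  ∑dropF-*ˡ c g []           = sym (ℤP.*-zeroʳ c)
  ∑dropF-*ˡ c g (true ∷ bs)  = ∑dropF-*ˡ c (g ∘ (true ∷_)) bs
  ∑dropF-*ˡ c g (false ∷ bs) =
    trans (cong (_+_ (c * g bs)) (∑dropF-*ˡ c _ bs)) (sym (ℤP.*-distribˡ-+ c _ _))

  ∑dropT-*ˡ : ∀ c g bs → ∑dropT (λ x → c * g x) bs ≡ c * ∑dropT g bs
  ∑dropT-*ˡ c g []           = sym (ℤP.*-zeroʳ c)
  ∑dropT-*ˡ c g (false ∷ bs) = ∑dropT-*ˡ c (g ∘ (false ∷_)) bs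
  ∑dropT-*ˡ c g (true ∷ bs)  =
    trans (cong (_+_ (c * g bs)) (∑dropT-*ˡ c _ bs)) (sym (ℤP.*-distribˡ-+ c _ _))

  ∑drop-split : ∀ g bs → + ∑drop g bs ≡ ∑dropF (+_ ∘ g) bs + ∑dropT (+_ ∘ g) bs
  ∑drop-split g []           = refl
  ∑drop-split g (true ∷ bs)  =
    trans (ℤP.pos-+ (g bs) _)
      (trans (cong (_+_ (+ g bs)) (∑drop-split g' bs)) (ring (+ g bs) (∑dropF (+_ ∘ g') bs) _))
    where
    g' : List Bool → ℕ
    g' = g ∘ (true ∷_)
    ring : ∀ a b c → a + (b + c) ≡ b + (a + c)
    ring = ℤSolver.solve-∀
  ∑drop-split g (false ∷ bs) =
    trans (ℤP.pos-+ (g bs) _)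
      (trans (cong (_+_ (+ g bs)) (∑drop-split g' bs)) (sym (ℤP.+-assoc (+ g bs) (∑dropF (+_ ∘ g') bs) _)))
    where g' : List Bool → ℕ
          g' = g ∘ (false ∷_)

  -- A factor depending only on #T can be pulled out of the deletion sums:
  -- deleting an ordinary bit keeps #T, deleting a special bit lowers it by one.
  ∑dropF-weight : ∀ (W : ℕ → ℤ) c h bs →
                  ∑dropF (λ x → W (c ℕ.+ #T x) * h x) bs ≡ W (c ℕ.+ #T bs) * ∑dropF h bs
  ∑dropF-weight W c h []           = sym (ℤP.*-zeroʳ (W (c ℕ.+ 0)))
  ∑dropF-weight W c h (false ∷ bs) =
    trans (cong (_+_ (W (c ℕ.+ #T bs) * h bs)) (∑dropF-weight W c (h ∘ (false ∷_)) bs))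
          (sym (ℤP.*-distribˡ-+ (W (c ℕ.+ #T bs)) (h bs) _))
  ∑dropF-weight W c h (true ∷ bs)  =
    trans (∑dropF-cong bs (λ x _ → cong (λ k → W k * h (true ∷ x)) (ℕP.+-suc c (#T x))))
      (trans (∑dropF-weight W (suc c) (h ∘ (true ∷_)) bs)
             (cong (λ k → W k * ∑dropF (h ∘ (true ∷_)) bs) (sym (ℕP.+-suc c (#T bs)))))

  ∑dropT-weight : ∀ (W : ℕ → ℤ) c h bs →
                  ∑dropT (λ x → W (suc (c ℕ.+ #T x)) * h x) bs ≡ W (c ℕ.+ #T bs) * ∑dropT h bs
  ∑dropT-weight W c h []           = sym (ℤP.*-zeroʳ (W (c ℕ.+ 0)))
  ∑dropT-weight W c h (false ∷ bs) = ∑dropT-weight W c (h ∘ (false ∷_)) bs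
  ∑dropT-weight W c h (true ∷ bs)  =
    trans (cong₂ _+_ (cong (λ k → W k * h bs) (sym (ℕP.+-suc c (#T bs)))) rest)
          (sym (ℤP.*-distribˡ-+ (W (c ℕ.+ suc (#T bs))) (h bs) _))
    where
    rest : ∑dropT (λ x → W (suc (c ℕ.+ suc (#T x))) * h (true ∷ x)) bs
         ≡ W (c ℕ.+ suc (#T bs)) * ∑dropT (h ∘ (true ∷_)) bs
    rest =
      trans (∑dropT-cong bs (λ x _ → cong (λ k → W (suc k) * h (true ∷ x)) (ℕP.+-suc c (#T x))))
        (trans (∑dropT-weight W (suc c) (h ∘ (true ∷_)) bs)
               (cong (λ k → W k * ∑dropT (h ∘ (true ∷_)) bs) (sym (ℕP.+-suc c (#T bs)))))

  ∑dropT-ballot : ∀ bs d → ∑dropT (ballot d) bs ≡ ballot (d + 1ℤ) bs - ballot d bs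
  ∑dropT-ballot []           d = sym (ℤP.+-inverseʳ 1ℤ)
  ∑dropT-ballot (false ∷ bs) d = ∑dropT-ballot bs (d + 1ℤ)
  ∑dropT-ballot (true ∷ bs)  d =
    begin
      ballot d bs + ∑dropT (λ x → d * ballot (d - 1ℤ) x) bs
    ≡⟨ cong (_+_ (ballot d bs)) (trans (∑dropT-*ˡ d _ bs) (cong (d *_) (∑dropT-ballot bs (d - 1ℤ)))) ⟩
      ballot d bs + d * (ballot (d - 1ℤ + 1ℤ) bs - ballot (d - 1ℤ) bs)
    ≡⟨ cong (λ e → ballot d bs + d * (ballot e bs - ballot (d - 1ℤ) bs)) (ring₁ d) ⟩
      ballot d bs + d * (ballot d bs - ballot (d - 1ℤ) bs)
    ≡⟨ ring₂ d (ballot d bs) (ballot (d - 1ℤ) bs) ⟩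
      (d + 1ℤ) * ballot d bs - d * ballot (d - 1ℤ) bs
    ≡⟨ cong (λ e → (d + 1ℤ) * ballot e bs - d * ballot (d - 1ℤ) bs) (sym (ring₃ d)) ⟩
      (d + 1ℤ) * ballot (d + 1ℤ - 1ℤ) bs - d * ballot (d - 1ℤ) bs
    ∎
    where
    open ≡-Reasoning
    ring₁ : ∀ a → a - 1ℤ + 1ℤ ≡ a
    ring₁ = ℤSolver.solve-∀
    ring₂ : ∀ a b c → b + a * (b - c) ≡ (a + 1ℤ) * b - a * c
    ring₂ = ℤSolver.solve-∀
    ring₃ : ∀ a → a + 1ℤ - 1ℤ ≡ a
    ring₃ = ℤSolver.solve-∀

  ∑dropF-ballot : ∀ bs d → ∑dropF (ballot d) bs ≡ (excess bs + d) * ballot d bs - d * ballot (d - 1ℤ) bs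
  ∑dropF-ballot []           d = ring d
    where ring : ∀ a → 0ℤ ≡ (0ℤ + a) * 1ℤ - a * 1ℤ
          ring = ℤSolver.solve-∀
  ∑dropF-ballot (false ∷ bs) d =
    begin
      ballot d bs + ∑dropF (ballot (d + 1ℤ)) bs
    ≡⟨ cong (_+_ (ballot d bs)) (∑dropF-ballot bs (d + 1ℤ)) ⟩
      ballot d bs + ((E + (d + 1ℤ)) * ballot (d + 1ℤ) bs - (d + 1ℤ) * ballot (d + 1ℤ - 1ℤ) bs)
    ≡⟨ cong (λ e → ballot d bs + ((E + (d + 1ℤ)) * ballot (d + 1ℤ) bs - (d + 1ℤ) * ballot e bs)) (ring₁ d) ⟩
      ballot d bs + ((E + (d + 1ℤ)) * ballot (d + 1ℤ) bs - (d + 1ℤ) * ballot d bs)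
    ≡⟨ ring₂ E d (ballot (d + 1ℤ) bs) (ballot d bs) ⟩
      (E + 1ℤ + d) * ballot (d + 1ℤ) bs - d * ballot d bs
    ≡⟨ cong (λ e → (E + 1ℤ + d) * ballot (d + 1ℤ) bs - d * ballot e bs) (sym (ring₃ d)) ⟩
      (E + 1ℤ + d) * ballot (d + 1ℤ) bs - d * ballot (d - 1ℤ + 1ℤ) bs
    ∎
    where
    open ≡-Reasoning
    E = excess bs
    ring₁ : ∀ a → a + 1ℤ - 1ℤ ≡ a
    ring₁ = ℤSolver.solve-∀
    ring₂ : ∀ e a b c → c + ((e + (a + 1ℤ)) * b - (a + 1ℤ) * c) ≡ (e + 1ℤ + a) * b - a * c
    ring₂ = ℤSolver.solve-∀
    ring₃ : ∀ a → a - 1ℤ + 1ℤ ≡ a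
    ring₃ = ℤSolver.solve-∀
  ∑dropF-ballot (true ∷ bs) d =
    begin
      ∑dropF (λ x → d * ballot (d - 1ℤ) x) bs
    ≡⟨ ∑dropF-*ˡ d _ bs ⟩
      d * ∑dropF (ballot (d - 1ℤ)) bs
    ≡⟨ cong (d *_) (∑dropF-ballot bs (d - 1ℤ)) ⟩
      d * ((E + (d - 1ℤ)) * ballot (d - 1ℤ) bs - (d - 1ℤ) * ballot (d - 1ℤ - 1ℤ) bs)
    ≡⟨ ring E d (ballot (d - 1ℤ) bs) (ballot (d - 1ℤ - 1ℤ) bs) ⟩
      (E - 1ℤ + d) * (d * ballot (d - 1ℤ) bs) - d * ((d - 1ℤ) * ballot (d - 1ℤ - 1ℤ) bs)
    ∎
    where
    open ≡-Reasoning
    E = excess bs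
    ring : ∀ e a b c → a * ((e + (a - 1ℤ)) * b - (a - 1ℤ) * c) ≡ (e - 1ℤ + a) * (a * b) - a * ((a - 1ℤ) * c)
    ring = ℤSolver.solve-∀

  -- With more special bits than ordinary bits plus d, the counter reaches 0
  -- at a special bit, so the ballot product vanishes.
  ballot-vanishes : ∀ bs d → d ℕ.+ #F bs < #T bs → ballot (+ d) bs ≡ 0ℤ
  ballot-vanishes (false ∷ bs) d lt =
    trans (cong (λ k → ballot (+ k) bs) (ℕP.+-comm d 1))
          (ballot-vanishes bs (suc d) (subst (_< #T bs) (ℕP.+-suc d (#F bs)) lt))
  ballot-vanishes (true ∷ bs) zero    lt       = refl
  ballot-vanishes (true ∷ bs) (suc d) (s≤s lt) =
    trans (cong (+ suc d *_) (ballot-vanishes bs d lt)) (ℤP.*-zeroʳ (+ suc d))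

  -- For a string of length 2r+1 with t ≤ r special bits the excess is
  -- 2(r−t)+1, which turns (2(r−t)−1)!! into (2(r−t)+1)!!; for t > r the
  -- ballot product vanishes.
  excess-balance : ∀ r bs → length bs ≡ suc (r ℕ.+ r) →
                   + oddFact (r ∸ #T bs) * excess bs * ballot 0ℤ bs
                 ≡ + oddFact (suc r ∸ #T bs) * ballot 0ℤ bs
  excess-balance r bs len with #T bs ≤? r
  ... | yes t≤r =
    begin
      + oddFact u * excess bs * P
    ≡⟨ cong (λ e → + oddFact u * e * P) (trans (excess≡#F-#T bs) (cong (λ k → + k - + t) #F≡)) ⟩
      + oddFact u * (+ (suc (u ℕ.+ u) ℕ.+ t) - + t) * P
    ≡⟨ cong (λ e → + oddFact u * (e - + t) * P) (ℤP.pos-+ (suc (u ℕ.+ u)) t) ⟩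
      + oddFact u * ((+ suc (u ℕ.+ u) + + t) - + t) * P
    ≡⟨ ring (+ oddFact u) (+ suc (u ℕ.+ u)) (+ t) P ⟩
      + suc (u ℕ.+ u) * + oddFact u * P
    ≡⟨ cong (_* P) (sym (ℤP.pos-* (suc (u ℕ.+ u)) (oddFact u))) ⟩
      + oddFact (suc u) * P
    ≡⟨ cong (λ k → + oddFact k * P) (sym (ℕP.+-∸-assoc 1 t≤r)) ⟩
      + oddFact (suc r ∸ t) * P
    ∎
    where
    open ≡-Reasoning
    t = #T bs
    u = r ∸ t
    P = ballot 0ℤ bs
    #F≡ : #F bs ≡ suc (u ℕ.+ u) ℕ.+ t
    #F≡ = ℕP.+-cancelʳ-≡ t (#F bs) (suc (u ℕ.+ u) ℕ.+ t)
            (trans (#F+#T bs) (trans len (trans (cong (λ k → suc (k ℕ.+ k)) (sym (ℕP.m+[n∸m]≡n t≤r)))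
                                                (ringℕ t u))))
      where ringℕ : ∀ t u → suc ((t ℕ.+ u) ℕ.+ (t ℕ.+ u)) ≡ (suc (u ℕ.+ u) ℕ.+ t) ℕ.+ t
            ringℕ = ℕSolver.solve-∀
    ring : ∀ a b c p → a * ((b + c) - c) * p ≡ b * a * p
    ring = ℤSolver.solve-∀
  ... | no t≰r =
    begin
      + oddFact (r ∸ t) * excess bs * ballot 0ℤ bs
    ≡⟨ cong (+ oddFact (r ∸ t) * excess bs *_) P≡0 ⟩
      + oddFact (r ∸ t) * excess bs * 0ℤ
    ≡⟨ ℤP.*-zeroʳ (+ oddFact (r ∸ t) * excess bs) ⟩
      0ℤ
    ≡⟨ ℤP.*-zeroʳ (+ oddFact (suc r ∸ t)) ⟨
      + oddFact (suc r ∸ t) * 0ℤ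
    ≡⟨ cong (+ oddFact (suc r ∸ t) *_) P≡0 ⟨
      + oddFact (suc r ∸ t) * ballot 0ℤ bs
    ∎
    where
    open ≡-Reasoning
    t = #T bs
    -- 2t ≥ 2r+2 > |bs| = #F + t, so #F < t
    #F<t : #F bs < t
    #F<t = ℕP.+-cancelʳ-< t (#F bs) t
             (subst (λ k → suc k ≤ t ℕ.+ t) (sym (trans (#F+#T bs) len))
                    (subst (_≤ t ℕ.+ t) (cong suc (ℕP.+-suc r r)) (ℕP.+-mono-≤ (ℕP.≰⇒> t≰r) (ℕP.≰⇒> t≰r))))
    P≡0 : ballot 0ℤ bs ≡ 0ℤ
    P≡0 = ballot-vanishes bs 0 #F<t

  -- Summing the closed form over all one-letter deletions of a string of
  -- length 2r+1: the #T-dependent weight comes out of each deletion sum,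
  -- ∑dropF/T-ballot evaluate what remains, and excess-balance cancels the
  -- terms that do not involve ballot 1.
  ∑drop-closedForm : ∀ r bs → length bs ≡ suc (r ℕ.+ r) →
                     ∑dropF (closedForm r) bs + ∑dropT (closedForm r) bs
                   ≡ + evenFact r * (ballot 1ℤ bs * + oddFact (suc r ∸ #T bs))
  ∑drop-closedForm r bs len =
    begin
      ∑dropF (closedForm r) bs + ∑dropT (closedForm r) bs
    ≡⟨ cong₂ _+_ (∑dropF-cong bs (λ x _ → weighted x)) (∑dropT-cong bs (λ x _ → weighted x)) ⟩
      ∑dropF (λ x → W₁ (#T x) * (C * P₀ x)) bs + ∑dropT (λ x → W₂ (suc (#T x)) * (C * P₀ x)) bs
    ≡⟨ cong₂ _+_ (∑dropF-weight W₁ 0 (λ x → C * P₀ x) bs) (∑dropT-weight W₂ 0 (λ x → C * P₀ x) bs) ⟩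
      W₁ t * ∑dropF (λ x → C * P₀ x) bs + W₂ t * ∑dropT (λ x → C * P₀ x) bs
    ≡⟨ cong₂ _+_ (cong (W₁ t *_) (trans (∑dropF-*ˡ C P₀ bs) (cong (C *_) (∑dropF-ballot bs 0ℤ))))
                 (cong (W₂ t *_) (trans (∑dropT-*ˡ C P₀ bs) (cong (C *_) (∑dropT-ballot bs 0ℤ)))) ⟩
      W₁ t * (C * ((E + 0ℤ) * P₀ bs - 0ℤ * ballot (0ℤ - 1ℤ) bs)) + W₂ t * (C * (P₁ - P₀ bs))
    ≡⟨ ring₁ C (W₁ t) (W₂ t) E (P₀ bs) P₁ (ballot (0ℤ - 1ℤ) bs) ⟩
      C * (W₁ t * E * P₀ bs - W₂ t * P₀ bs) + C * (P₁ * W₂ t)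
    ≡⟨ cong (λ e → C * (e - W₂ t * P₀ bs) + C * (P₁ * W₂ t)) (excess-balance r bs len) ⟩
      C * (W₂ t * P₀ bs - W₂ t * P₀ bs) + C * (P₁ * W₂ t)
    ≡⟨ ring₂ C (W₂ t * P₀ bs) (P₁ * W₂ t) ⟩
      C * (P₁ * W₂ t)
    ∎
    where
    open ≡-Reasoning
    C = + evenFact r
    t = #T bs
    E = excess bs
    P₀ = ballot 0ℤ
    P₁ = ballot 1ℤ bs
    W₁ W₂ : ℕ → ℤ
    W₁ k = + oddFact (r ∸ k)
    W₂ k = + oddFact (suc r ∸ k)
    weighted : ∀ x → closedForm r x ≡ W₁ (#T x) * (C * P₀ x)
    weighted x = ring (W₁ (#T x)) C (P₀ x)
      where ring : ∀ w c p → c * (p * w) ≡ w * (c * p)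
            ring = ℤSolver.solve-∀
    ring₁ : ∀ c w₁ w₂ e p₀ p₁ q →
            w₁ * (c * ((e + 0ℤ) * p₀ - 0ℤ * q)) + w₂ * (c * (p₁ - p₀))
          ≡ c * (w₁ * e * p₀ - w₂ * p₀) + c * (p₁ * w₂)
    ring₁ = ℤSolver.solve-∀
    ring₂ : ∀ c x y → c * (x - x) + c * y ≡ c * y
    ring₂ = ℤSolver.solve-∀

  crossoutCount-closed : ∀ r bs → length bs ≡ r ℕ.+ r → + crossoutCount r bs ≡ closedForm r bs
  crossoutCount-closed zero    []           refl = refl
  crossoutCount-closed (suc r) (true ∷ bs)  len  =
    sym (trans (cong (+ evenFact (suc r) *_) (ℤP.*-zeroˡ (+ oddFact (suc r ∸ #T (true ∷ bs)))))
               (ℤP.*-zeroʳ (+ evenFact (suc r))))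
  crossoutCount-closed (suc r) (false ∷ bs) len =
    begin
      + (suc (length bs) ℕ.* ∑drop (crossoutCount r) bs)
    ≡⟨ ℤP.pos-* (suc (length bs)) _ ⟩
      + suc (length bs) * + ∑drop (crossoutCount r) bs
    ≡⟨ cong₂ _*_ (cong (λ k → + suc k) len′) (∑drop-split (crossoutCount r) bs) ⟩
      s * (∑dropF (+_ ∘ crossoutCount r) bs + ∑dropT (+_ ∘ crossoutCount r) bs)
    ≡⟨ cong (s *_) (cong₂ _+_ (∑dropF-cong bs induction) (∑dropT-cong bs induction)) ⟩
      s * (∑dropF (closedForm r) bs + ∑dropT (closedForm r) bs)
    ≡⟨ cong (s *_) (∑drop-closedForm r bs len′) ⟩
      s * (+ evenFact r * (ballot 1ℤ bs * + oddFact (suc r ∸ #T bs)))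
    ≡⟨ sym (ℤP.*-assoc s (+ evenFact r) _) ⟩
      s * + evenFact r * (ballot 1ℤ bs * + oddFact (suc r ∸ #T bs))
    ≡⟨ cong (_* (ballot 1ℤ bs * + oddFact (suc r ∸ #T bs))) (sym (ℤP.pos-* (2 ℕ.+ (r ℕ.+ r)) (evenFact r))) ⟩
      closedForm (suc r) (false ∷ bs)
    ∎
    where
    open ≡-Reasoning
    len′ : length bs ≡ suc (r ℕ.+ r)
    len′ = trans (ℕP.suc-injective len) (ℕP.+-suc r r)
    s = + (2 ℕ.+ (r ℕ.+ r))
    induction : ∀ x → suc (length x) ≡ length bs → + crossoutCount r x ≡ closedForm r x
    induction x lx = crossoutCount-closed r x (ℕP.suc-injective (trans lx len′))

-- Arrangements: sequences of distinct elements drawn from a finite set,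
-- represented by a strictly increasing list S of elements of Fin N.

module Arrangements (N : ℕ) where

  Sorted : List (Fin N) → Set
  Sorted = AllPairs (λ a b → toℕ a < toℕ b)

  delete : Fin N → List (Fin N) → List (Fin N)
  delete x = filter (λ y → ¬? (y F.≟ x))

  arrangements : ℕ → List (Fin N) → List (List (Fin N))
  arrangements zero    S = [] ∷ []
  arrangements (suc L) S = concatMap (λ x → map (x ∷_) (arrangements L (delete x S))) S

  ∑-arrangements : ∀ L S f → ∑ (arrangements (suc L) S) f
                 ≡ ∑ S (λ x → ∑ (arrangements L (delete x S)) (λ v → f (x ∷ v)))
  ∑-arrangements L S f =
    trans (∑-concatMap (λ x → map (x ∷_) (arrangements L (delete x S))) S f)
          (∑-cong S (λ x → ∑-map (x ∷_) (arrangements L (delete x S)) f))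

  delete-≡ : ∀ {x t} T → t ≡ x → delete x (t ∷ T) ≡ delete x T
  delete-≡ T t≡x = LP.filter-reject (λ y → ¬? (y F.≟ _)) (λ t≢x → t≢x t≡x)

  delete-≢ : ∀ {x t} T → t ≢ x → delete x (t ∷ T) ≡ t ∷ delete x T
  delete-≢ T t≢x = LP.filter-accept (λ y → ¬? (y F.≟ _)) t≢x

  delete-∉ : ∀ x T → x ∉ T → delete x T ≡ T
  delete-∉ x T x∉ = LP.filter-all (λ y → ¬? (y F.≟ x)) (All.tabulate (λ y∈ y≡x → x∉ (subst (_∈ T) y≡x y∈)))

  ∈-delete⁻ : ∀ {y} x T → y ∈ delete x T → y ∈ T × y ≢ x
  ∈-delete⁻ x T = LMP.∈-filter⁻ (λ y → ¬? (y F.≟ x))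

  ∈-delete⁺ : ∀ {y} x T → y ∈ T → y ≢ x → y ∈ delete x T
  ∈-delete⁺ x T = LMP.∈-filter⁺ (λ y → ¬? (y F.≟ x))

  delete-sorted : ∀ x T → Sorted T → Sorted (delete x T)
  delete-sorted x T = APP.filter⁺ (λ y → ¬? (y F.≟ x))

  delete-All : ∀ {P : Fin N → Set} x T → All P T → All P (delete x T)
  delete-All x T = AllP.filter⁺ (λ y → ¬? (y F.≟ x))

  delete-comm : ∀ x y T → delete x (delete y T) ≡ delete y (delete x T)
  delete-comm x y = filter-comm (λ z → ¬? (z F.≟ x)) (λ z → ¬? (z F.≟ y))

  sorted-∉ : ∀ {t T} → Sorted (t ∷ T) → t ∉ T
  sorted-∉ ((lt ∷ _) ∷ _)          (here refl) = ℕP.<-irrefl refl lt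
  sorted-∉ ((_ ∷ lts) ∷ (_ ∷ s)) (there t∈)  = sorted-∉ (lts ∷ s) t∈

  sorted-≢ : ∀ {t T x} → Sorted (t ∷ T) → x ∈ T → x ≢ t
  sorted-≢ s x∈ refl = sorted-∉ s x∈

  delete-head : ∀ {t T} → Sorted (t ∷ T) → delete t (t ∷ T) ≡ T
  delete-head {t} {T} s = trans (delete-≡ T refl) (delete-∉ t T (sorted-∉ s))

  delete-length : ∀ x T → Sorted T → x ∈ T → suc (length (delete x T)) ≡ length T
  delete-length x (t ∷ T) s         (here refl) = cong (suc ∘ length) (delete-head s)
  delete-length x (t ∷ T) s@(_ ∷ sT) (there x∈) =
    trans (cong (suc ∘ length) (delete-≢ T (λ t≡x → sorted-≢ s x∈ (sym t≡x))))
          (cong suc (delete-length x T sT x∈))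

  ∑-delete : ∀ U m F → Sorted U → m ∈ U → ∑ U F ≡ F m ℕ.+ ∑ (delete m U) F
  ∑-delete (u ∷ U) m F s (here refl) = cong (λ l → F m ℕ.+ ∑ l F) (sym (delete-head s))
  ∑-delete (u ∷ U) m F s@(_ ∷ sU) (there m∈) =
    trans (cong (F u ℕ.+_) (∑-delete U m F sU m∈))
      (trans (ring (F u) (F m) (∑ (delete m U) F))
             (cong (λ l → F m ℕ.+ ∑ l F) (sym (delete-≢ U (λ u≡m → sorted-≢ s m∈ (sym u≡m))))))
    where ring : ∀ a b c → a ℕ.+ (b ℕ.+ c) ≡ b ℕ.+ (a ℕ.+ c)
          ring = ℕSolver.solve-∀

  IsArrangement : ℕ → List (Fin N) → List (Fin N) → Set
  IsArrangement L S v = (length v ≡ L) × (∀ y → y ∈ v → y ∈ S) × (L ≡ length S → ∀ y → y ∈ S → y ∈ v)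

  ∑-arrangements-cong : ∀ L S {f g} → Sorted S → (∀ v → IsArrangement L S v → f v ≡ g v) →
                        ∑ (arrangements L S) f ≡ ∑ (arrangements L S) g
  ∑-arrangements-cong zero S s e = cong (ℕ._+ 0) (e [] (refl , (λ y ()) , λ eq y y∈ → ⊥-elim (empty eq y∈)))
    where empty : ∀ {S : List (Fin N)} {y} → 0 ≡ length S → y ∈ S → ⊥
          empty {_ ∷ _} () _
  ∑-arrangements-cong (suc L) S {f} {g} s e =
    trans (∑-arrangements L S f)
      (trans (∑-cong∈ S (λ x x∈ → ∑-arrangements-cong L (delete x S) (delete-sorted x S s)
                                     (λ v v-arr → e (x ∷ v) (extend x x∈ v v-arr))))
             (sym (∑-arrangements L S g)))
    where
    extend : ∀ x → x ∈ S → ∀ v → IsArrangement L (delete x S) v → IsArrangement (suc L) S (x ∷ v)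
    extend x x∈ v (lv , inn , full) =
      cong suc lv ,
      (λ { y (here refl) → x∈ ; y (there y∈) → proj₁ (∈-delete⁻ x S (inn y y∈)) }) ,
      covers
      where
      covers : suc L ≡ length S → ∀ y → y ∈ S → y ∈ x ∷ v
      covers eq y y∈S with y F.≟ x
      ... | yes refl = here refl
      ... | no y≢x   = there (full (ℕP.suc-injective (trans eq (sym (delete-length x S s x∈))))
                                   y (∈-delete⁺ x S y∈S y≢x))

  -- The part of a deletion sum coming from the arrangements that start with z.
  startingWith : ℕ → List (Fin N) → Fin N → (List (Fin N) → ℕ) → Fin N → ℕ
  startingWith L U m h z = ∑ (arrangements L (delete z U)) (λ v → h (delete m (z ∷ v)))

  -- Splitting a deletion sum by the first letter: the arrangements starting
  -- with m contribute X, so it suffices that the others contribute L·X.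
  ∑-delete-split : ∀ L U m h → Sorted U → m ∈ U →
                   ∑ (delete m U) (startingWith L U m h) ≡ L ℕ.* ∑ (arrangements L (delete m U)) h →
                   ∑ (arrangements (suc L) U) (h ∘ delete m) ≡ suc L ℕ.* ∑ (arrangements L (delete m U)) h
  ∑-delete-split L U m h s m∈ others =
    begin
      ∑ (arrangements (suc L) U) (h ∘ delete m)
    ≡⟨ ∑-arrangements L U _ ⟩
      ∑ U (startingWith L U m h)
    ≡⟨ ∑-delete U m _ s m∈ ⟩
      startingWith L U m h m ℕ.+ ∑ (delete m U) (startingWith L U m h)
    ≡⟨ cong₂ ℕ._+_ starting-m others ⟩
      X ℕ.+ L ℕ.* X
    ∎
    where
    open ≡-Reasoning
    X = ∑ (arrangements L (delete m U)) h
    -- starting with m, deleting m just drops the first letter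
    starting-m : startingWith L U m h m ≡ X
    starting-m = ∑-arrangements-cong L (delete m U) (delete-sorted m U s)
      (λ v (_ , inn , _) → cong h (trans (delete-≡ v refl)
                                         (delete-∉ m v (λ m∈v → proj₂ (∈-delete⁻ m U (inn m m∈v)) refl))))

  -- Deletion lemma: deleting a fixed letter m from the arrangements of all of
  -- U yields every arrangement of U∖m exactly |U| times (once for each
  -- position where m can be inserted).
  ∑-delete-letter : ∀ L U m h → Sorted U → m ∈ U → length U ≡ suc L →
                    ∑ (arrangements (suc L) U) (h ∘ delete m) ≡ suc L ℕ.* ∑ (arrangements L (delete m U)) h
  ∑-delete-letter zero (u ∷ []) m h s (here refl) _ =
    ∑-delete-split zero (u ∷ []) m h s (here refl) (cong (λ l → ∑ l (startingWith 0 (u ∷ []) m h)) (delete-≡ {u} {u} [] refl))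
  ∑-delete-letter (suc L) U m h s m∈ lenU = ∑-delete-split (suc L) U m h s m∈
    (begin
      ∑ (delete m U) (startingWith (suc L) U m h)
    ≡⟨ ∑-cong∈ (delete m U) starting-z ⟩
      ∑ (delete m U) (λ z → suc L ℕ.* ∑ (arrangements L (delete z (delete m U))) (λ u → h (z ∷ u)))
    ≡⟨ ∑-*ˡ (delete m U) (suc L) _ ⟩
      suc L ℕ.* ∑ (delete m U) (λ z → ∑ (arrangements L (delete z (delete m U))) (λ u → h (z ∷ u)))
    ≡⟨ cong (suc L ℕ.*_) (sym (∑-arrangements L (delete m U) h)) ⟩
      suc L ℕ.* ∑ (arrangements (suc L) (delete m U)) h
    ∎)
    where
    open ≡-Reasoning
    -- starting with z ≠ m: m is deleted from the tail, an arrangement of U∖z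
    starting-z : ∀ z → z ∈ delete m U →
                 startingWith (suc L) U m h z ≡ suc L ℕ.* ∑ (arrangements L (delete z (delete m U))) (λ u → h (z ∷ u))
    starting-z z z∈ =
      let (z∈U , z≢m) = ∈-delete⁻ m U z∈ in
      begin
        ∑ (arrangements (suc L) (delete z U)) (λ v → h (delete m (z ∷ v)))
      ≡⟨ ∑-cong (arrangements (suc L) (delete z U)) (λ v → cong h (delete-≢ v z≢m)) ⟩
        ∑ (arrangements (suc L) (delete z U)) (λ v → h (z ∷ delete m v))
      ≡⟨ ∑-delete-letter L (delete z U) m (λ u → h (z ∷ u)) (delete-sorted z U s)
           (∈-delete⁺ z U m∈ (λ m≡z → z≢m (sym m≡z)))
           (ℕP.suc-injective (trans (delete-length z U s z∈U) lenU)) ⟩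
        suc L ℕ.* ∑ (arrangements L (delete m (delete z U))) (λ u → h (z ∷ u))
      ≡⟨ cong (λ l → suc L ℕ.* ∑ (arrangements L l) (λ u → h (z ∷ u))) (delete-comm m z U) ⟩
        suc L ℕ.* ∑ (arrangements L (delete z (delete m U))) (λ u → h (z ∷ u))
      ∎

module ValueCrossout (N : ℕ) (K : ℕ → Bool) where
  open Arrangements N
  open CrossoutCount using (crossoutCount; ∑drop)

  special : Fin N → Bool
  special x = K (toℕ x)

  -- the smallest value of a sequence (N for the empty one)
  minValue : List (Fin N) → ℕ
  minValue = foldr (λ x r → toℕ x ⊓ r) N

  dropValue : ℕ → List (Fin N) → List (Fin N)
  dropValue c = filter (λ x → ¬? (toℕ x ℕ.≟ c))

  noSpecial : List (Fin N) → Bool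
  noSpecial []       = true
  noSpecial (y ∷ vs) = not (special y) ∧ noSpecial vs

  -- allEatenByA r vs: during r crossout rounds on vs no special value is
  -- marked B (the smallest value) and afterwards none is left unmarked; the
  -- A-mark removes the first remaining letter.
  mutual
    allEatenByA : ℕ → List (Fin N) → Bool
    allEatenByA zero    vs = noSpecial vs
    allEatenByA (suc r) vs = afterB r vs (dropValue (minValue vs) vs)

    afterB : ℕ → List (Fin N) → List (Fin N) → Bool
    afterB r vs []         = noSpecial vs
    afterB r vs (a ∷ rest) = not (K (minValue vs)) ∧ allEatenByA r rest

  minValue-lower : ∀ c vs → c ≤ N → All (λ y → c ≤ toℕ y) vs → c ≤ minValue vs
  minValue-lower c []       c≤N []          = c≤N
  minValue-lower c (y ∷ vs) c≤N (c≤y ∷ c≤vs) = ℕP.⊓-glb c≤y (minValue-lower c vs c≤N c≤vs)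

  minValue-upper : ∀ {y} vs → y ∈ vs → minValue vs ≤ toℕ y
  minValue-upper (x ∷ vs) (here refl) = ℕP.m⊓n≤m (toℕ x) (minValue vs)
  minValue-upper (x ∷ vs) (there y∈)  = ℕP.≤-trans (ℕP.m⊓n≤n (toℕ x) (minValue vs)) (minValue-upper vs y∈)

  minValue-is : ∀ m vs → m ∈ vs → All (λ y → toℕ m ≤ toℕ y) vs → minValue vs ≡ toℕ m
  minValue-is m vs m∈ m≤vs =
    ℕP.≤-antisym (minValue-upper vs m∈) (minValue-lower (toℕ m) vs (ℕP.<⇒≤ (FP.toℕ<n m)) m≤vs)

  -- values are distinct, so dropping the value of m deletes m
  dropValue-delete : ∀ m vs → dropValue (toℕ m) vs ≡ delete m vs
  dropValue-delete m = LP.filter-≐ (λ x → ¬? (toℕ x ℕ.≟ toℕ m)) (λ y → ¬? (y F.≟ m))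
    ((λ ne e → ne (cong toℕ e)) , (λ ne e → ne (FP.toℕ-injective e)))

  allEatenByA-min-first : ∀ r m y vs → All (λ z → toℕ m < toℕ z) (y ∷ vs) →
                          allEatenByA (suc r) (m ∷ y ∷ vs) ≡ not (special m) ∧ allEatenByA r vs
  allEatenByA-min-first r m y vs m<  =
    trans (cong (afterB r (m ∷ y ∷ vs)) afterRound) (cong (λ c → not (K c) ∧ allEatenByA r vs) min≡)
    where
    min≡ : minValue (m ∷ y ∷ vs) ≡ toℕ m
    min≡ = minValue-is m _ (here refl) (ℕP.≤-refl ∷ All.map ℕP.<⇒≤ m<)
    afterRound : dropValue (minValue (m ∷ y ∷ vs)) (m ∷ y ∷ vs) ≡ y ∷ vs
    afterRound = trans (cong (λ c → dropValue c (m ∷ y ∷ vs)) min≡)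
      (trans (LP.filter-reject (λ x → ¬? (toℕ x ℕ.≟ toℕ m)) (λ ne → ne refl))
             (LP.filter-all (λ x → ¬? (toℕ x ℕ.≟ toℕ m)) (All.map (λ lt e → ℕP.<-irrefl (sym e) lt) m<)))

  allEatenByA-min-later : ∀ r m x vs → toℕ m < toℕ x → m ∈ vs → All (λ z → toℕ m ≤ toℕ z) vs →
                          allEatenByA (suc r) (x ∷ vs) ≡ not (special m) ∧ allEatenByA r (delete m vs)
  allEatenByA-min-later r m x vs m<x m∈ m≤ =
    trans (cong (afterB r (x ∷ vs)) afterRound) (cong (λ c → not (K c) ∧ allEatenByA r (delete m vs)) min≡)
    where
    min≡ : minValue (x ∷ vs) ≡ toℕ m
    min≡ = minValue-is m _ (there m∈) (ℕP.<⇒≤ m<x ∷ m≤)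
    afterRound : dropValue (minValue (x ∷ vs)) (x ∷ vs) ≡ x ∷ delete m vs
    afterRound = trans (cong (λ c → dropValue c (x ∷ vs)) min≡)
      (trans (LP.filter-accept (λ x → ¬? (toℕ x ℕ.≟ toℕ m)) (λ e → ℕP.<-irrefl (sym e) m<x))
             (cong (x ∷_) (dropValue-delete m vs)))

  count : ℕ → List (Fin N) → ℕ
  count r S = ∑ (arrangements (r ℕ.+ r) S) (𝟙 ∘ allEatenByA r)

  ∑-delete-pattern : ∀ T g → Sorted T → ∑ T (λ x → g (map special (delete x T))) ≡ ∑drop g (map special T)
  ∑-delete-pattern []      g s = refl
  ∑-delete-pattern (t ∷ T) g s@(_ ∷ sT) =
    cong₂ ℕ._+_ (cong (g ∘ map special) (delete-head s))
      (trans (∑-cong∈ T (λ x x∈ → cong (g ∘ map special) (delete-≢ T (λ t≡x → sorted-≢ s x∈ (sym t≡x)))))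
             (∑-delete-pattern T (g ∘ (special t ∷_)) sT))

  -- the recursion of crossoutCount, written uniformly in the first bit
  crossoutCount-step : ∀ r b bs → length bs ≡ suc (r ℕ.+ r) →
                       𝟙 (not b) ℕ.* (suc (suc (r ℕ.+ r)) ℕ.* ∑drop (crossoutCount r) bs)
                     ≡ crossoutCount (suc r) (b ∷ bs)
  crossoutCount-step r true  bs len = refl
  crossoutCount-step r false bs len =
    trans (ℕP.+-identityʳ _) (cong (λ k → suc k ℕ.* ∑drop (crossoutCount r) bs) (sym len))

  -- Arrangements of m ∷ T (m the minimum) that start with m: the first round
  -- crosses out m and the second letter, leaving an arrangement of T∖y.
  count-min-first : ∀ r m T → Sorted (m ∷ T) →
                    ∑ (arrangements (suc (r ℕ.+ r)) T) (λ v → 𝟙 (allEatenByA (suc r) (m ∷ v)))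
                  ≡ 𝟙 (not (special m)) ℕ.* ∑ T (λ y → count r (delete y T))
  count-min-first r m T (m<T ∷ sT) =
    begin
      ∑ (arrangements (suc (r ℕ.+ r)) T) (λ v → 𝟙 (allEatenByA (suc r) (m ∷ v)))
    ≡⟨ ∑-arrangements (r ℕ.+ r) T _ ⟩
      ∑ T (λ y → ∑ (arrangements (r ℕ.+ r) (delete y T)) (λ v → 𝟙 (allEatenByA (suc r) (m ∷ y ∷ v))))
    ≡⟨ ∑-cong∈ T (λ y y∈ → ∑-arrangements-cong (r ℕ.+ r) (delete y T) (delete-sorted y T sT)
                                 (λ v (_ , inn , _) → round y y∈ v inn)) ⟩
      ∑ T (λ y → ∑ (arrangements (r ℕ.+ r) (delete y T)) (λ v → a ℕ.* 𝟙 (allEatenByA r v)))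
    ≡⟨ ∑-cong T (λ y → ∑-*ˡ (arrangements (r ℕ.+ r) (delete y T)) a _) ⟩
      ∑ T (λ y → a ℕ.* count r (delete y T))
    ≡⟨ ∑-*ˡ T a _ ⟩
      a ℕ.* ∑ T (λ y → count r (delete y T))
    ∎
    where
    open ≡-Reasoning
    a = 𝟙 (not (special m))
    round : ∀ y → y ∈ T → ∀ v → (∀ z → z ∈ v → z ∈ delete y T) →
            𝟙 (allEatenByA (suc r) (m ∷ y ∷ v)) ≡ a ℕ.* 𝟙 (allEatenByA r v)
    round y y∈ v inn =
      trans (cong 𝟙 (allEatenByA-min-first r m y v
                       (All.lookup m<T y∈ ∷ All.tabulate (λ {z} z∈ → All.lookup m<T (proj₁ (∈-delete⁻ y T (inn z z∈)))))))
            (𝟙-∧ (not (special m)) (allEatenByA r v))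

  -- Arrangements of m ∷ T that start with some x ∈ T: the first round
  -- crosses out x and m; by the deletion lemma each arrangement of
  -- T∖x is reached 2r+1 times.
  count-min-later : ∀ r m T x → Sorted (m ∷ T) → length T ≡ suc (r ℕ.+ r) → x ∈ T →
                    ∑ (arrangements (suc (r ℕ.+ r)) (m ∷ delete x T)) (λ v → 𝟙 (allEatenByA (suc r) (x ∷ v)))
                  ≡ 𝟙 (not (special m)) ℕ.* (suc (r ℕ.+ r) ℕ.* count r (delete x T))
  count-min-later r m T x (m<T ∷ sT) lenT x∈ =
    begin
      ∑ (arrangements L₁ U) (λ v → 𝟙 (allEatenByA (suc r) (x ∷ v)))
    ≡⟨ ∑-arrangements-cong L₁ U sU round ⟩
      ∑ (arrangements L₁ U) (λ v → a ℕ.* 𝟙 (allEatenByA r (delete m v)))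
    ≡⟨ ∑-*ˡ (arrangements L₁ U) a _ ⟩
      a ℕ.* ∑ (arrangements L₁ U) (𝟙 ∘ allEatenByA r ∘ delete m)
    ≡⟨ cong (a ℕ.*_) (∑-delete-letter (r ℕ.+ r) U m (𝟙 ∘ allEatenByA r) sU (here refl) lenU) ⟩
      a ℕ.* (L₁ ℕ.* ∑ (arrangements (r ℕ.+ r) (delete m U)) (𝟙 ∘ allEatenByA r))
    ≡⟨ cong (λ l → a ℕ.* (L₁ ℕ.* count r l)) (delete-head sU) ⟩
      a ℕ.* (L₁ ℕ.* count r (delete x T))
    ∎
    where
    open ≡-Reasoning
    a = 𝟙 (not (special m))
    L₁ = suc (r ℕ.+ r)
    U = m ∷ delete x T
    sU : Sorted U
    sU = delete-All x T m<T ∷ delete-sorted x T sT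
    lenU : length U ≡ L₁
    lenU = cong suc (ℕP.suc-injective (trans (delete-length x T sT x∈) lenT))
    m≤U : ∀ {z} → z ∈ U → toℕ m ≤ toℕ z
    m≤U (here refl) = ℕP.≤-refl
    m≤U (there z∈)  = ℕP.<⇒≤ (All.lookup m<T (proj₁ (∈-delete⁻ x T z∈)))
    round : ∀ v → IsArrangement L₁ U v → 𝟙 (allEatenByA (suc r) (x ∷ v)) ≡ a ℕ.* 𝟙 (allEatenByA r (delete m v))
    round v (_ , inn , full) =
      trans (cong 𝟙 (allEatenByA-min-later r m x v (All.lookup m<T x∈) (full (sym lenU) m (here refl))
                       (All.tabulate (λ {z} z∈ → m≤U (inn z z∈)))))
            (𝟙-∧ (not (special m)) (allEatenByA r (delete m v)))

  count≡crossoutCount : ∀ r S → Sorted S → length S ≡ r ℕ.+ r → count r S ≡ crossoutCount r (map special S)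
  count≡crossoutCount zero    []      s refl = refl
  count≡crossoutCount (suc r) (m ∷ T) s@(_ ∷ sT) len =
    begin
      ∑ (arrangements (suc r ℕ.+ suc r) (m ∷ T)) f
    ≡⟨ cong (λ k → ∑ (arrangements (suc k) (m ∷ T)) f) (ℕP.+-suc r r) ⟩
      ∑ (arrangements (suc L₁) (m ∷ T)) f
    ≡⟨ ∑-arrangements L₁ (m ∷ T) f ⟩
      firstLetter m ℕ.+ ∑ T firstLetter
    ≡⟨ cong₂ ℕ._+_ (trans (cong (λ l → ∑ (arrangements L₁ l) (λ v → f (m ∷ v))) (delete-head s))
                          (count-min-first r m T s))
                   (trans (∑-cong∈ T later) (trans (∑-*ˡ T a _) (cong (a ℕ.*_) (∑-*ˡ T L₁ _)))) ⟩
      a ℕ.* Σ ℕ.+ a ℕ.* (L₁ ℕ.* Σ)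
    ≡⟨ ring a Σ L₁ ⟩
      a ℕ.* (suc L₁ ℕ.* Σ)
    ≡⟨ cong (λ z → a ℕ.* (suc L₁ ℕ.* z)) Σ≡ ⟩
      a ℕ.* (suc L₁ ℕ.* ∑drop (crossoutCount r) (map special T))
    ≡⟨ crossoutCount-step r (special m) (map special T) (trans (LP.length-map special T) lenT) ⟩
      crossoutCount (suc r) (map special (m ∷ T))
    ∎
    where
    open ≡-Reasoning
    L₁ = suc (r ℕ.+ r)
    f = 𝟙 ∘ allEatenByA (suc r)
    a = 𝟙 (not (special m))
    Σ = ∑ T (λ y → count r (delete y T))
    firstLetter : Fin N → ℕ
    firstLetter x = ∑ (arrangements L₁ (delete x (m ∷ T))) (λ v → f (x ∷ v))
    lenT : length T ≡ L₁
    lenT = trans (ℕP.suc-injective len) (ℕP.+-suc r r)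
    later : ∀ x → x ∈ T → firstLetter x ≡ a ℕ.* (L₁ ℕ.* count r (delete x T))
    later x x∈ = trans (cong (λ l → ∑ (arrangements L₁ l) (λ v → f (x ∷ v)))
                             (delete-≢ T (λ m≡x → sorted-≢ s x∈ (sym m≡x))))
                       (count-min-later r m T x s lenT x∈)
    Σ≡ : Σ ≡ ∑drop (crossoutCount r) (map special T)
    Σ≡ = trans (∑-cong∈ T (λ x x∈ → count≡crossoutCount r (delete x T) (delete-sorted x T sT)
                                       (ℕP.suc-injective (trans (delete-length x T sT x∈) lenT))))
               (∑-delete-pattern T (crossoutCount r) sT)
    ring : ∀ a s l → a ℕ.* s ℕ.+ a ℕ.* (l ℕ.* s) ≡ a ℕ.* (suc l ℕ.* s)
    ring = ℕSolver.solve-∀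

module PositionCrossout (N : ℕ) (K : ℕ → Bool) where
  import Defs
  open ValueCrossout N K using (minValue; dropValue; noSpecial; allEatenByA; afterB)

  Entry : Set
  Entry = Fin N × Fin N

  values : List Entry → List (Fin N)
  values = map proj₂

  removeMin : List Entry → List Entry
  removeMin = Defs.removeMin {N}

  rounds : ℕ → List Entry → List (Fin N)
  rounds = Defs.rounds {N}

  minEntry : List Entry → ℕ
  minEntry = foldr (λ p r → toℕ (proj₂ p) ⊓ r) N

  isSpecial : Entry → Set
  isSpecial p = K (toℕ (proj₂ p)) ≡ true

  SpecialInA : ℕ → List Entry → Set
  SpecialInA r l = ∀ p → p ∈ l → isSpecial p → proj₁ p ∈ rounds r l

  DistinctPositions : List Entry → Set
  DistinctPositions l = Unique (map proj₁ l)

  distinct-positions : ∀ {p q} l → DistinctPositions l → p ∈ l → q ∈ l → proj₁ p ≡ proj₁ q → p ≡ q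
  distinct-positions (x ∷ l) u       (here refl) (here refl) e = refl
  distinct-positions (x ∷ l) (a ∷ u) (here refl) (there q∈)  e = ⊥-elim (All.lookup a (LMP.∈-map⁺ proj₁ q∈) e)
  distinct-positions (x ∷ l) (a ∷ u) (there p∈)  (here refl) e = ⊥-elim (All.lookup a (LMP.∈-map⁺ proj₁ p∈) (sym e))
  distinct-positions (x ∷ l) (a ∷ u) (there p∈)  (there q∈)  e = distinct-positions l u p∈ q∈ e

  minEntry≡minValue : ∀ l → minEntry l ≡ minValue (values l)
  minEntry≡minValue l = sym (LP.foldr-map _ proj₂ N l)

  values-removeMin : ∀ l → values (removeMin l) ≡ dropValue (minValue (values l)) (values l)
  values-removeMin l =
    trans (map-filter proj₂ (λ x → ¬? (toℕ x ℕ.≟ minEntry l)) l)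
          (cong (λ c → dropValue c (values l)) (minEntry≡minValue l))

  ∈-removeMin⁻ : ∀ {p} l → p ∈ removeMin l → p ∈ l × toℕ (proj₂ p) ≢ minEntry l
  ∈-removeMin⁻ l = LMP.∈-filter⁻ (λ p → ¬? (toℕ (proj₂ p) ℕ.≟ minEntry l))

  ∈-removeMin⁺ : ∀ {p} l → p ∈ l → toℕ (proj₂ p) ≢ minEntry l → p ∈ removeMin l
  ∈-removeMin⁺ l = LMP.∈-filter⁺ (λ p → ¬? (toℕ (proj₂ p) ℕ.≟ minEntry l))

  distinct-removeMin : ∀ l → DistinctPositions l → DistinctPositions (removeMin l)
  distinct-removeMin l u = APP.map⁺ (APP.filter⁺ (λ p → ¬? (toℕ (proj₂ p) ℕ.≟ minEntry l)) (APP.map⁻ u))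

  minEntry-attained : ∀ l → l ≢ [] → ∃ λ e → e ∈ l × toℕ (proj₂ e) ≡ minEntry l
  minEntry-attained []          l≢[] = ⊥-elim (l≢[] refl)
  minEntry-attained (p ∷ [])    _    = p , here refl , sym (ℕP.m≤n⇒m⊓n≡m (ℕP.<⇒≤ (FP.toℕ<n (proj₂ p))))
  minEntry-attained (p ∷ q ∷ l) _
    with minEntry-attained (q ∷ l) (λ ()) | ℕP.⊓-sel (toℕ (proj₂ p)) (minEntry (q ∷ l))
  ... | _           | inj₁ e = p , here refl , sym e
  ... | x , x∈ , ex | inj₂ e = x , there x∈ , trans ex (sym e)

  rounds-exhausted : ∀ r l → removeMin l ≡ [] → rounds (suc r) l ≡ []
  rounds-exhausted r l eq rewrite eq = refl

  rounds-continue : ∀ r l {i v rest} → removeMin l ≡ (i , v) ∷ rest → rounds (suc r) l ≡ i ∷ rounds r rest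
  rounds-continue r l eq rewrite eq = refl

  allEatenByA-exhausted : ∀ r l → removeMin l ≡ [] → allEatenByA (suc r) (values l) ≡ noSpecial (values l)
  allEatenByA-exhausted r l eq = cong (afterB r (values l)) (trans (sym (values-removeMin l)) (cong values eq))

  allEatenByA-continue : ∀ r l {i v rest} → removeMin l ≡ (i , v) ∷ rest →
                         allEatenByA (suc r) (values l) ≡ not (K (minEntry l)) ∧ allEatenByA r (values rest)
  allEatenByA-continue r l eq =
    trans (cong (afterB r (values l)) (trans (sym (values-removeMin l)) (cong values eq)))
          (cong (λ c → not (K c) ∧ _) (sym (minEntry≡minValue l)))

  rounds-positions : ∀ {q} r l → q ∈ rounds (suc r) l → ∃ λ p → p ∈ removeMin l × proj₁ p ≡ q
  rounds-positions r l q∈ with removeMin l in eq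
  rounds-positions r l () | []
  rounds-positions r l (here q≡i) | (i , v) ∷ rest = (i , v) , here refl , sym q≡i
  rounds-positions (suc r) l (there q∈) | (i , v) ∷ rest with rounds-positions r rest q∈
  ... | p , p∈ , e = p , there (proj₁ (∈-removeMin⁻ rest p∈)) , e

  NoSpecialEntry : List Entry → Set
  NoSpecialEntry l = ∀ p → p ∈ l → isSpecial p → ⊥

  noSpecial-sound : ∀ l → noSpecial (values l) ≡ true → NoSpecialEntry l
  noSpecial-sound (q ∷ l) h p (here refl) k rewrite k = case h
    where case : false ∧ noSpecial (values l) ≡ true → ⊥
          case ()
  noSpecial-sound (q ∷ l) h p (there p∈) k =
    noSpecial-sound l (proj₂ (∧-true⁻ (not (K (toℕ (proj₂ q)))) _ h)) p p∈ k

  noSpecial-complete : ∀ l → NoSpecialEntry l → noSpecial (values l) ≡ true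
  noSpecial-complete []      h = refl
  noSpecial-complete (q ∷ l) h with K (toℕ (proj₂ q)) in k
  ... | true  = ⊥-elim (h q (here refl) k)
  ... | false = noSpecial-complete l (λ p p∈ → h p (there p∈))

  continue⇒ : ∀ r l {i v rest} → removeMin l ≡ (i , v) ∷ rest → DistinctPositions l →
              SpecialInA (suc r) l → not (K (minEntry l)) ≡ true × SpecialInA r rest
  continue⇒ r l {i} {v} {rest} eq u h = minOrdinary , restInA
    where
    removed : ∀ {p} → p ∈ (i , v) ∷ rest → p ∈ l × toℕ (proj₂ p) ≢ minEntry l
    removed p∈ = ∈-removeMin⁻ l (subst (_ ∈_) (sym eq) p∈)
    nonempty : l ≢ []
    nonempty l≡[] with () ← trans (sym (cong removeMin l≡[])) eq
    minOrdinary : not (K (minEntry l)) ≡ true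
    minOrdinary with K (minEntry l) in k
    ... | false = refl
    ... | true with minEntry-attained l nonempty
    ...   | e , e∈ , e-min with rounds-positions r l (h e e∈ (trans (cong K e-min) k))
    ...     | p , p∈ , same with ∈-removeMin⁻ l p∈
    ...       | p∈l , p-not-min = ⊥-elim (p-not-min (subst (λ x → toℕ (proj₂ x) ≡ minEntry l)
                                                         (distinct-positions l u e∈ p∈l (sym same)) e-min))
    restInA : SpecialInA r rest
    restInA p p∈ k with subst (_ ∈_) (rounds-continue r l eq) (h p (proj₁ (removed (there p∈))) k)
    ... | here p≡i with subst DistinctPositions eq (distinct-removeMin l u)
    ...   | i∉rest ∷ _ = ⊥-elim (All.lookup i∉rest (LMP.∈-map⁺ proj₁ p∈) (sym p≡i))
    restInA p p∈ k | there p∈rounds = p∈rounds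

  continue⇐ : ∀ r l {i v rest} → removeMin l ≡ (i , v) ∷ rest →
              not (K (minEntry l)) ≡ true → SpecialInA r rest → SpecialInA (suc r) l
  continue⇐ r l eq minOrdinary restInA p p∈ k with toℕ (proj₂ p) ℕ.≟ minEntry l
  ... | yes p-min = ⊥-elim (notTrue minOrdinary (trans (cong K (sym p-min)) k))
    where notTrue : ∀ {b} → not b ≡ true → b ≡ true → ⊥
          notTrue {true} () _
  ... | no p-not-min with subst (p ∈_) eq (∈-removeMin⁺ l p∈ p-not-min)
  ...   | here refl  = subst (_ ∈_) (sym (rounds-continue r l eq)) (here refl)
  ...   | there p∈r = subst (_ ∈_) (sym (rounds-continue r l eq)) (there (restInA p p∈r k))

  specialInA⇔allEatenByA : ∀ r l → DistinctPositions l →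
                           (SpecialInA r l → allEatenByA r (values l) ≡ true)
                         × (allEatenByA r (values l) ≡ true → SpecialInA r l)
  specialInA⇔allEatenByA zero l u =
    (λ h → noSpecial-complete l (λ p p∈ k → case (h p p∈ k))) ,
    (λ h p p∈ k → ⊥-elim (noSpecial-sound l h p p∈ k))
    where case : ∀ {x : Fin N} → x ∈ [] → ⊥
          case ()
  specialInA⇔allEatenByA (suc r) l u = byFirstRound (removeMin l) refl
    where
    case : ∀ {x : Fin N} → x ∈ [] → ⊥
    case ()
    byFirstRound : ∀ x → removeMin l ≡ x →
                   (SpecialInA (suc r) l → allEatenByA (suc r) (values l) ≡ true)
                 × (allEatenByA (suc r) (values l) ≡ true → SpecialInA (suc r) l)
    byFirstRound [] eq =
      (λ h → trans (allEatenByA-exhausted r l eq)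
                   (noSpecial-complete l (λ p p∈ k → case (subst (_ ∈_) (rounds-exhausted r l eq) (h p p∈ k))))) ,
      (λ h p p∈ k → ⊥-elim (noSpecial-sound l (trans (sym (allEatenByA-exhausted r l eq)) h) p p∈ k))
    byFirstRound ((i , v) ∷ rest) eq =
      (λ h → let (minOrd , restInA) = continue⇒ r l eq u h in
             trans (allEatenByA-continue r l eq) (cong₂ _∧_ minOrd (proj₁ IH restInA))) ,
      (λ h → let (minOrd , restOK) = ∧-true⁻ _ _ (trans (sym (allEatenByA-continue r l eq)) h) in
             continue⇐ r l eq minOrd (proj₂ IH restOK))
      where
      tail-distinct : ∀ {x xs} → Unique (x ∷ xs) → Unique xs
      tail-distinct (_ ∷ u) = u
      IH : (SpecialInA r rest → allEatenByA r (values rest) ≡ true)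
         × (allEatenByA r (values rest) ≡ true → SpecialInA r rest)
      IH = specialInA⇔allEatenByA r rest (tail-distinct (subst DistinctPositions eq (distinct-removeMin l u)))

module WordsAsArrangements (N : ℕ) where
  open Arrangements N
  open import Defs using (words; perms; unique?)
  open import Data.Bool using (_∨_)
  import Data.Bool.Properties as BP

  elem : Fin N → List (Fin N) → Bool
  elem x []       = false
  elem x (y ∷ ys) = does (x F.≟ y) ∨ elem x ys

  distinct : List (Fin N) → Bool
  distinct []       = true
  distinct (x ∷ xs) = not (elem x xs) ∧ distinct xs

  within : List (Fin N) → List (Fin N) → Bool
  within S []       = true
  within S (y ∷ ys) = elem y S ∧ within S ys

  elem-sound : ∀ x ys → elem x ys ≡ true → x ∈ ys
  elem-sound x (y ∷ ys) e with x F.≟ y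
  ... | yes x≡y = here x≡y
  ... | no _    = there (elem-sound x ys e)

  elem-complete : ∀ x ys → x ∈ ys → elem x ys ≡ true
  elem-complete x (y ∷ ys) x∈ with x F.≟ y | x∈
  ... | yes _ | _         = refl
  ... | no ne | here x≡y  = ⊥-elim (ne x≡y)
  ... | no _  | there x∈′ = elem-complete x ys x∈′

  elem-∉ : ∀ x ys → x ∉ ys → elem x ys ≡ false
  elem-∉ x ys x∉ with elem x ys in e
  ... | true  = ⊥-elim (x∉ (elem-sound x ys e))
  ... | false = refl

  ≟-sym : ∀ (x y : Fin N) → does (x F.≟ y) ≡ does (y F.≟ x)
  ≟-sym x y with x F.≟ y | y F.≟ x
  ... | yes _ | yes _  = refl
  ... | no _  | no _   = refl
  ... | yes e | no ne  = ⊥-elim (ne (sym e))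
  ... | no ne | yes e  = ⊥-elim (ne (sym e))

  elem-delete : ∀ y x S → elem y (delete x S) ≡ elem y S ∧ not (does (y F.≟ x))
  elem-delete y x [] = refl
  elem-delete y x (s ∷ S) = byHead (s F.≟ x)
    where
    byHead : Dec (s ≡ x) → elem y (delete x (s ∷ S)) ≡ elem y (s ∷ S) ∧ not (does (y F.≟ x))
    byHead (yes s≡x) =
      trans (cong (elem y) (delete-≡ S s≡x)) (trans (elem-delete y x S) (bool (y F.≟ s) (y F.≟ x)))
      where
      bool : (d₁ : Dec (y ≡ s)) (d₂ : Dec (y ≡ x)) → elem y S ∧ not (does d₂) ≡ (does d₁ ∨ elem y S) ∧ not (does d₂)
      bool (yes _)   (yes _)   = BP.∧-zeroʳ (elem y S)
      bool (no _)    _         = refl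
      bool (yes y≡s) (no y≢x)  = ⊥-elim (y≢x (trans y≡s s≡x))
    byHead (no s≢x) =
      trans (cong (elem y) (delete-≢ S s≢x))
        (trans (cong (does (y F.≟ s) ∨_) (elem-delete y x S)) (bool (y F.≟ s) (y F.≟ x)))
      where
      bool : (d₁ : Dec (y ≡ s)) (d₂ : Dec (y ≡ x)) →
             does d₁ ∨ (elem y S ∧ not (does d₂)) ≡ (does d₁ ∨ elem y S) ∧ not (does d₂)
      bool (yes _)   (no _)    = refl
      bool (no _)    _         = refl
      bool (yes y≡s) (yes y≡x) = ⊥-elim (s≢x (trans (sym y≡s) y≡x))

  within-delete : ∀ x S w → not (elem x w) ∧ within S w ≡ within (delete x S) w
  within-delete x S []       = refl
  within-delete x S (y ∷ w) =
    trans (bool (does (x F.≟ y)) (elem x w) (elem y S) (within S w))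
      (trans (cong₂ _∧_ (cong (λ b → elem y S ∧ not b) (≟-sym x y)) (within-delete x S w))
             (cong (_∧ within (delete x S) w) (sym (elem-delete y x S))))
    where
    bool : ∀ a b c d → not (a ∨ b) ∧ (c ∧ d) ≡ (c ∧ not a) ∧ (not b ∧ d)
    bool true  b     c     d = sym (cong (_∧ (not b ∧ d)) (BP.∧-zeroʳ c))
    bool false true  c     d = sym (BP.∧-zeroʳ (c ∧ true))
    bool false false true  d = refl
    bool false false false d = refl

  sorted-allFin : Sorted (allFin N)
  sorted-allFin = APP.tabulate⁺-< (λ i<j → i<j)

  ∑-indicator : ∀ xs S F → Sorted xs → Sorted S → (∀ y → y ∈ S → y ∈ xs) →
                ∑ xs (λ x → 𝟙 (elem x S) ℕ.* F x) ≡ ∑ S F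
  ∑-indicator []       []      F sx sS sub = refl
  ∑-indicator []       (s ∷ S) F sx sS sub with () ← sub s (here refl)
  ∑-indicator (a ∷ xs) S F sx@(_ ∷ sxs) sS sub =
    trans (cong (𝟙 (elem a S) ℕ.* F a ℕ.+_)
                (trans (∑-cong∈ xs (λ x x∈ → cong (λ b → 𝟙 b ℕ.* F x) (elem-rest x x∈)))
                       (∑-indicator xs (delete a S) F sxs (delete-sorted a S sS) sub′)))
          (head-term (elem a S) refl)
    where
    elem-rest : ∀ x → x ∈ xs → elem x S ≡ elem x (delete a S)
    elem-rest x x∈ =
      sym (trans (elem-delete x a S) (trans (cong (λ b → elem x S ∧ not b) (dec-no (x F.≟ a))) (BP.∧-identityʳ _)))
      where dec-no : (d : Dec (x ≡ a)) → does d ≡ false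
            dec-no (yes x≡a) = ⊥-elim (sorted-≢ sx x∈ x≡a)
            dec-no (no _)    = refl
    sub′ : ∀ y → y ∈ delete a S → y ∈ xs
    sub′ y y∈ with ∈-delete⁻ a S y∈
    ... | y∈S , y≢a with sub y y∈S
    ...   | here y≡a  = ⊥-elim (y≢a y≡a)
    ...   | there y∈xs = y∈xs
    head-term : ∀ b → elem a S ≡ b → 𝟙 b ℕ.* F a ℕ.+ ∑ (delete a S) F ≡ ∑ S F
    head-term true  e = trans (cong (ℕ._+ ∑ (delete a S) F) (ℕP.*-identityˡ (F a)))
                              (sym (∑-delete S a F sS (elem-sound a S e)))
    head-term false e = cong (λ l → ∑ l F) (delete-∉ a S (λ a∈ → case (trans (sym e) (elem-complete a S a∈))))
      where case : false ≡ true → ⊥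
            case ()

  onArrangements : List (Fin N) → (List (Fin N) → ℕ) → List (Fin N) → ℕ
  onArrangements S f l = 𝟙 (distinct l ∧ within S l) ℕ.* f l

  onArrangements-∷ : ∀ S f x l → onArrangements S f (x ∷ l)
                   ≡ 𝟙 (elem x S) ℕ.* onArrangements (delete x S) (λ v → f (x ∷ v)) l
  onArrangements-∷ S f x l =
    trans (cong (λ b → 𝟙 b ℕ.* f (x ∷ l))
                (trans (bool (elem x l) (distinct l) (elem x S) (within S l))
                       (cong (λ b → elem x S ∧ (distinct l ∧ b)) (within-delete x S l))))
      (trans (cong (ℕ._* f (x ∷ l)) (𝟙-∧ (elem x S) (distinct l ∧ within (delete x S) l)))
             (ℕP.*-assoc (𝟙 (elem x S)) _ (f (x ∷ l))))
    where
    bool : ∀ a b c d → (not a ∧ b) ∧ (c ∧ d) ≡ c ∧ (b ∧ (not a ∧ d))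
    bool true  b     c     d = sym (trans (cong (c ∧_) (BP.∧-zeroʳ b)) (BP.∧-zeroʳ c))
    bool false true  true  d = refl
    bool false true  false d = refl
    bool false false true  d = refl
    bool false false false d = refl

  ∑-words : ∀ len S f → Sorted S →
            ∑ (words N len) (onArrangements S f ∘ toList) ≡ ∑ (arrangements len S) f
  ∑-words zero    S f sS = cong (ℕ._+ 0) (ℕP.+-identityʳ (f []))
  ∑-words (suc len) S f sS =
    begin
      ∑ (words N (suc len)) (onArrangements S f ∘ toList)
    ≡⟨ ∑-concatMap (λ x → map (x V.∷_) (words N len)) (allFin N) _ ⟩
      ∑ (allFin N) (λ x → ∑ (map (x V.∷_) (words N len)) (onArrangements S f ∘ toList))
    ≡⟨ ∑-cong (allFin N) firstLetter ⟩
      ∑ (allFin N) (λ x → 𝟙 (elem x S) ℕ.* ∑ (arrangements len (delete x S)) (λ v → f (x ∷ v)))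
    ≡⟨ ∑-indicator (allFin N) S _ sorted-allFin sS (λ y _ → LMP.∈-allFin y) ⟩
      ∑ S (λ x → ∑ (arrangements len (delete x S)) (λ v → f (x ∷ v)))
    ≡⟨ ∑-arrangements len S f ⟨
      ∑ (arrangements (suc len) S) f
    ∎
    where
    open ≡-Reasoning
    firstLetter : ∀ x → ∑ (map (x V.∷_) (words N len)) (onArrangements S f ∘ toList)
                      ≡ 𝟙 (elem x S) ℕ.* ∑ (arrangements len (delete x S)) (λ v → f (x ∷ v))
    firstLetter x =
      trans (∑-map (x V.∷_) (words N len) _)
        (trans (∑-cong (words N len) (λ w → onArrangements-∷ S f x (toList w)))
          (trans (∑-*ˡ (words N len) (𝟙 (elem x S)) _)
                 (cong (𝟙 (elem x S) ℕ.*_) (∑-words len (delete x S) (λ v → f (x ∷ v)) (delete-sorted x S sS)))))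

  distinct≡unique? : ∀ xs → does (unique? xs) ≡ distinct xs
  distinct≡unique? xs = does-≡ (unique? xs) (distinct xs) (to xs) (from xs)
    where
    to : ∀ xs → Unique xs → distinct xs ≡ true
    to []       _       = refl
    to (x ∷ xs) (x∉ ∷ u) = cong₂ _∧_ (cong not (elem-∉ x xs (λ x∈ → All.lookup x∉ x∈ refl))) (to xs u)
    from : ∀ xs → distinct xs ≡ true → Unique xs
    from []       _ = []
    from (x ∷ xs) h with ∧-true⁻ (not (elem x xs)) _ h
    ... | x-new , rest = All.tabulate (λ {y} y∈ x≡y → x∉ (subst (_∈ xs) (sym x≡y) y∈)) ∷ from xs rest
      where
      x∉ : x ∉ xs
      x∉ x∈ with () ← trans (cong not (sym (elem-complete x xs x∈))) x-new

  within-allFin : ∀ xs → within (allFin N) xs ≡ true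
  within-allFin []       = refl
  within-allFin (x ∷ xs) = cong₂ _∧_ (elem-complete x (allFin N) (LMP.∈-allFin x)) (within-allFin xs)

  ∑-perms : ∀ f → ∑ (perms N) (f ∘ toList) ≡ ∑ (arrangements N (allFin N)) f
  ∑-perms f =
    begin
      ∑ (perms N) (f ∘ toList)
    ≡⟨ ∑-filter (unique? ∘ toList) (words N N) _ ⟩
      ∑ (words N N) (λ w → 𝟙 (does (unique? (toList w))) ℕ.* f (toList w))
    ≡⟨ ∑-cong (words N N) (λ w → cong (λ b → 𝟙 b ℕ.* f (toList w)) (isArrangement (toList w))) ⟩
      ∑ (words N N) (onArrangements (allFin N) f ∘ toList)
    ≡⟨ ∑-words N (allFin N) f sorted-allFin ⟩
      ∑ (arrangements N (allFin N)) f
    ∎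
    where
    open ≡-Reasoning
    isArrangement : ∀ xs → does (unique? xs) ≡ distinct xs ∧ within (allFin N) xs
    isArrangement xs = trans (distinct≡unique? xs)
                             (trans (sym (BP.∧-identityʳ _)) (cong (distinct xs ∧_) (sym (within-allFin xs))))

foldrFrom : {A B : Set} → (ℕ → B → A → A) → A → ℕ → List B → A
foldrFrom f e o []       = e
foldrFrom f e o (k ∷ kl) = f o k (foldrFrom f e (suc o) kl)

-- the factor k − (2i − 1) of the (i+1)-st special value k is
-- numerator i k; numerators i kl multiplies them for kl = k_{i+1}, k_{i+2}, …
numerator : ℕ → ℕ → ℤ
numerator i k = + k ℤ.- + (2 ℕ.* suc i ∸ 1)

numerators : ℕ → List ℕ → ℤ
numerators = foldrFrom (λ i k r → numerator i k ℤ.* r) 1ℤ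

module SpecialPattern (K : ℕ → Bool) where
  open import Data.List.Membership.DecPropositional ℕ._≟_ using (_∈?_)
  open import Relation.Nullary.Decidable using (dec-true; dec-false)
  open import Data.Integer using (_+_; _*_; _-_)
  open CrossoutCount using (ballot; #T)

  bitsFrom : ℕ → ℕ → List Bool
  bitsFrom s zero      = []
  bitsFrom s (suc len) = K s ∷ bitsFrom (suc s) len


  length-bitsFrom : ∀ s len → length (bitsFrom s len) ≡ len
  length-bitsFrom s zero      = refl
  length-bitsFrom s (suc len) = cong suc (length-bitsFrom (suc s) len)

  bitsFrom-tabulate : ∀ {N} len s (g : Fin len → Fin N) → (∀ i → toℕ (g i) ≡ s ℕ.+ toℕ i) →
                      map (K ∘ toℕ) (tabulate g) ≡ bitsFrom s len
  bitsFrom-tabulate zero      s g g≡ = refl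
  bitsFrom-tabulate (suc len) s g g≡ =
    cong₂ _∷_ (cong K (trans (g≡ F.zero) (ℕP.+-identityʳ s)))
              (bitsFrom-tabulate len (suc s) (g ∘ F.suc) (λ i → trans (g≡ (F.suc i)) (ℕP.+-suc s (toℕ i))))

  -- kl lists, increasing and 1-indexed, the special values ≥ s, and all
  -- of them lie in [s, s+len)
  record Window (s len : ℕ) (kl : List ℕ) : Set where
    field
      increasing : AllPairs _<_ kl
      inRange    : All (λ k → s < k × k ≤ s ℕ.+ len) kl
      agrees     : ∀ v → s ≤ v → K v ≡ does (suc v ∈? kl)

  empty-window : ∀ {s kl} → Window s 0 kl → kl ≡ []
  empty-window {s} {[]}    w = refl
  empty-window {s} {k ∷ _} w with Window.inRange w
  ... | (s<k , k≤s) ∷ _ = ⊥-elim (ℕP.<-irrefl refl (ℕP.<-≤-trans s<k (subst (k ≤_) (ℕP.+-identityʳ s) k≤s)))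

  data FirstValue (s len : ℕ) : List ℕ → Set where
    specialFirst  : ∀ {kl} → K s ≡ true  → Window (suc s) len kl → FirstValue s len (suc s ∷ kl)
    ordinaryFirst : ∀ {kl} → K s ≡ false → Window (suc s) len kl → FirstValue s len kl

  firstValue : ∀ {s len kl} → Window s (suc len) kl → FirstValue s len kl
  firstValue {s} {len} {[]} w =
    ordinaryFirst (Window.agrees w s ℕP.≤-refl)
             (record { increasing = [] ; inRange = [] ; agrees = λ v s<v → Window.agrees w v (ℕP.<⇒≤ s<v) })
  firstValue {s} {len} {k ∷ kl} w with Window.increasing w | Window.inRange w
  ... | k<kl ∷ incr | (s<k , k≤) ∷ range with ℕP.m≤n⇒m<n∨m≡n s<k
  ...   | inj₂ refl = specialFirst (trans (Window.agrees w s ℕP.≤-refl) (dec-true (suc s ∈? suc s ∷ kl) (here refl)))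
      (record
        { increasing = incr
        ; inRange    = All.zipWith (λ (k< , (_ , k′≤)) → k< , ℕP.≤-trans k′≤ (ℕP.≤-reflexive (ℕP.+-suc s len))) (k<kl , range)
        ; agrees     = λ v s<v → trans (Window.agrees w v (ℕP.<⇒≤ s<v))
                                       (does-≡ (suc v ∈? suc s ∷ kl) (does (suc v ∈? kl))
                                               (λ { (here e) → ⊥-elim (ℕP.<-irrefl (sym e) (s≤s s<v))
                                                  ; (there v∈) → dec-true (suc v ∈? kl) v∈ })
                                               (there ∘ witness (suc v ∈? kl)))
        })
  ...   | inj₁ s+1<k = ordinaryFirst (trans (Window.agrees w s ℕP.≤-refl) (dec-false (suc s ∈? k ∷ kl) s+1∉))
      (record
        { increasing = k<kl ∷ incr
        ; inRange    = (s+1<k , subst (k ≤_) (ℕP.+-suc s len) k≤)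
                       ∷ All.zipWith (λ (k< , (_ , k′≤)) → ℕP.<-trans s+1<k k< , ℕP.≤-trans k′≤ (ℕP.≤-reflexive (ℕP.+-suc s len)))
                                     (k<kl , range)
        ; agrees     = λ v s<v → Window.agrees w v (ℕP.<⇒≤ s<v)
        })
    where
    s+1∉ : suc s ∉ k ∷ kl
    s+1∉ (here e)  = ℕP.<-irrefl e s+1<k
    s+1∉ (there e) = ℕP.<-irrefl refl (ℕP.<-trans s+1<k (All.lookup k<kl e))

  #T-bits : ∀ len s kl → Window s len kl → #T (bitsFrom s len) ≡ length kl
  #T-bits zero      s kl w rewrite empty-window w = refl
  #T-bits (suc len) s kl w with firstValue w
  ... | specialFirst  {kl′} k w′ rewrite k = cong suc (#T-bits len (suc s) kl′ w′)
  ... | ordinaryFirst        k w′ rewrite k = #T-bits len (suc s) kl w′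

  -- At the special value k_j − 1 the counter of ballot equals
  -- (k_j − 1 − (j − 1)) − (j − 1) = k_j − (2j − 1): with i special values
  -- passed before s, the counter at s is s − 2i.
  ballot-bits : ∀ len s i kl → Window s len kl → ballot (+ s - + (2 ℕ.* i)) (bitsFrom s len) ≡ numerators i kl
  ballot-bits zero      s i kl w rewrite empty-window w = refl
  ballot-bits (suc len) s i kl w with firstValue w
  ... | specialFirst {kl′} k w′ rewrite k =
    cong₂ _*_ (trans (ring₁ (+ s) (+ (2 ℕ.* i))) (cong (λ b → + suc s - + b) (sym twice-suc-∸1)))
              (trans (cong (λ d → ballot d (bitsFrom (suc s) len))
                           (trans (ring₂ (+ s) (+ (2 ℕ.* i))) (cong (λ b → + suc s - + b) (sym twice-suc))))
                     (ballot-bits len (suc s) (suc i) kl′ w′))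
    where
    twice-suc : 2 ℕ.* suc i ≡ suc (suc (2 ℕ.* i))
    twice-suc = ℕP.*-suc 2 i
    twice-suc-∸1 : 2 ℕ.* suc i ∸ 1 ≡ suc (2 ℕ.* i)
    twice-suc-∸1 = cong (_∸ 1) twice-suc
    ring₁ : ∀ a b → a - b ≡ (1ℤ + a) - (1ℤ + b)
    ring₁ = ℤSolver.solve-∀
    ring₂ : ∀ a b → a - b - 1ℤ ≡ (1ℤ + a) - (1ℤ + (1ℤ + b))
    ring₂ = ℤSolver.solve-∀
  ... | ordinaryFirst k w′ rewrite k =
    trans (cong (λ d → ballot d (bitsFrom (suc s) len)) (ring (+ s) (+ (2 ℕ.* i))))
          (ballot-bits len (suc s) i kl w′)
    where
    ring : ∀ a b → a - b + 1ℤ ≡ (1ℤ + a) - b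
    ring = ℤSolver.solve-∀

∈-toList⁻ : ∀ {m} {x : ℕ} (ks : Vec ℕ m) → x ∈ toList ks → ∃ λ j → x ≡ lookup ks j
∈-toList⁻ ks x∈ = let x∈ks = VMP.∈-toList⁻ x∈ in VAny.index x∈ks , VAnyP.lookup-index x∈ks

lookup∈toList : ∀ {m} (ks : Vec ℕ m) j → lookup ks j ∈ toList ks
lookup∈toList ks j = VMP.∈-toList⁺ (VMP.∈-lookup j ks)

increasing-toList : ∀ {m} (ks : Vec ℕ m) → (∀ (i j : Fin m) → i F.< j → lookup ks i < lookup ks j) →
                    AllPairs _<_ (toList ks)
increasing-toList V.[]       inc = []
increasing-toList (k V.∷ ks) inc =
  All.tabulate (λ {x} x∈ → let (j , x≡) = ∈-toList⁻ ks x∈ in subst (k <_) (sym x≡) (inc F.zero (F.suc j) (s≤s z≤n)))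
  ∷ increasing-toList ks (λ i j i<j → inc (F.suc i) (F.suc j) (s≤s i<j))

module Entries {N : ℕ} where

  entries-positions : ∀ {m} (g : Fin m → Fin N) (w : Vec (Fin N) m) → map proj₁ (zip (tabulate g) (toList w)) ≡ tabulate g
  entries-positions {zero}  g V.[]       = refl
  entries-positions {suc m} g (x V.∷ w) = cong (g F.zero ∷_) (entries-positions (g ∘ F.suc) w)

  entries-values : ∀ {m} (g : Fin m → Fin N) (w : Vec (Fin N) m) → map proj₂ (zip (tabulate g) (toList w)) ≡ toList w
  entries-values {zero}  g V.[]       = refl
  entries-values {suc m} g (x V.∷ w) = cong (x ∷_) (entries-values (g ∘ F.suc) w)

  ∈-entries⁻ : ∀ {m} (g : Fin m → Fin N) (w : Vec (Fin N) m) {p} → p ∈ zip (tabulate g) (toList w) →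
               ∃ λ j → proj₁ p ≡ g j × proj₂ p ≡ lookup w j
  ∈-entries⁻ {suc m} g (x V.∷ w) (here refl) = F.zero , refl , refl
  ∈-entries⁻ {suc m} g (x V.∷ w) (there p∈) with ∈-entries⁻ (g ∘ F.suc) w p∈
  ... | j , e₁ , e₂ = F.suc j , e₁ , e₂

  ∈-entries⁺ : ∀ {m} (g : Fin m → Fin N) (w : Vec (Fin N) m) j → (g j , lookup w j) ∈ zip (tabulate g) (toList w)
  ∈-entries⁺ {suc m} g (x V.∷ w) F.zero    = here refl
  ∈-entries⁺ {suc m} g (x V.∷ w) (F.suc j) = there (∈-entries⁺ (g ∘ F.suc) w j)

module Favourable (n m : ℕ) (ks : Vec ℕ m)
                  (k≥1 : ∀ (j : Fin m) → 1 ≤ lookup ks j)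
                  (k≤2n : ∀ (j : Fin m) → lookup ks j ≤ 2 ℕ.* n)
                  (increasing : ∀ (i j : Fin m) → i F.< j → lookup ks i < lookup ks j) where
  open import Defs using (Event; event?; perms)
  open import Data.List.Membership.DecPropositional ℕ._≟_ using (_∈?_)
  open import Relation.Nullary.Decidable using (dec-true)
  open Entries
  open CrossoutCount

  N : ℕ
  N = 2 ℕ.* n

  kl : List ℕ
  kl = toList ks

  -- the special values (0-indexed) are k − 1 for k in ks
  K : ℕ → Bool
  K v = does (suc v ∈? kl)

  open SpecialPattern K

  open ValueCrossout N K using (allEatenByA; special; count; count≡crossoutCount)
  open PositionCrossout N K using (SpecialInA; DistinctPositions; specialInA⇔allEatenByA)
  open Arrangements N using (arrangements)
  open WordsAsArrangements N using (∑-perms; sorted-allFin)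

  module _ (w : Vec (Fin N) N) where
    state : List (Fin N × Fin N)
    state = zip (allFin N) (toList w)

    distinct-positions : DistinctPositions state
    distinct-positions = subst Unique (sym (entries-positions (λ i → i) w))
                               (AP.map (λ lt e → ℕP.<-irrefl (cong toℕ e) lt) sorted-allFin)

    event⇒specialInA : Event n ks w → SpecialInA n state
    event⇒specialInA h p p∈ k with ∈-entries⁻ (λ i → i) w p∈ | ∈-toList⁻ ks (witness (suc (toℕ (proj₂ p)) ∈? kl) k)
    ... | i , pos≡ , val≡ | j , k≡ = h (proj₁ p) (j , trans (cong (suc ∘ toℕ) (trans (cong (lookup w) pos≡) (sym val≡))) k≡)

    specialInA⇒event : SpecialInA n state → Event n ks w
    specialInA⇒event h i (j , k≡) =
      h (i , lookup w i) (∈-entries⁺ (λ i → i) w i)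
        (dec-true (suc (toℕ (lookup w i)) ∈? kl) (subst (_∈ kl) (sym k≡) (lookup∈toList ks j)))

    event≡allEatenByA : does (event? n ks w) ≡ allEatenByA n (toList w)
    event≡allEatenByA =
      does-≡ (event? n ks w) (allEatenByA n (toList w))
        (λ h → subst (λ vs → allEatenByA n vs ≡ true) (entries-values (λ i → i) w)
                     (proj₁ (specialInA⇔allEatenByA n state distinct-positions) (event⇒specialInA h)))
        (λ h → specialInA⇒event (proj₂ (specialInA⇔allEatenByA n state distinct-positions)
                     (subst (λ vs → allEatenByA n vs ≡ true) (sym (entries-values (λ i → i) w)) h)))

  N≡n+n : N ≡ n ℕ.+ n
  N≡n+n = cong (n ℕ.+_) (ℕP.+-identityʳ n)

  favourable : ℕ
  favourable = length (filter (event? n ks) (perms N))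

  favourable≡crossoutCount : favourable ≡ crossoutCount n (map special (allFin N))
  favourable≡crossoutCount =
    begin
      length (filter (event? n ks) (perms N))
    ≡⟨ length-filter (event? n ks) (perms N) ⟩
      ∑ (perms N) (𝟙 ∘ does ∘ event? n ks)
    ≡⟨ ∑-cong (perms N) (cong 𝟙 ∘ event≡allEatenByA) ⟩
      ∑ (perms N) (𝟙 ∘ allEatenByA n ∘ toList)
    ≡⟨ ∑-perms (𝟙 ∘ allEatenByA n) ⟩
      ∑ (arrangements N (allFin N)) (𝟙 ∘ allEatenByA n)
    ≡⟨ cong (λ L → ∑ (arrangements L (allFin N)) (𝟙 ∘ allEatenByA n)) N≡n+n ⟩
      count n (allFin N)
    ≡⟨ count≡crossoutCount n (allFin N) sorted-allFin (trans (LP.length-tabulate (λ i → i)) N≡n+n) ⟩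
      crossoutCount n (map special (allFin N))
    ∎
    where open ≡-Reasoning

  window : Window 0 N kl
  window = record
    { increasing = increasing-toList ks increasing
    ; inRange    = All.tabulate (λ {x} x∈ → let (j , x≡) = ∈-toList⁻ ks x∈ in
                                  subst (0 <_) (sym x≡) (k≥1 j) , subst (_≤ N) (sym x≡) (k≤2n j))
    ; agrees     = λ v _ → refl
    }

  favourable-closed : + favourable ≡ + evenFact n ℤ.* (numerators 0 kl ℤ.* + oddFact (n ∸ m))
  favourable-closed =
    begin
      + favourable
    ≡⟨ cong +_ (trans favourable≡crossoutCount (cong (crossoutCount n) pattern≡bits)) ⟩
      + crossoutCount n (bitsFrom 0 N)
    ≡⟨ crossoutCount-closed n (bitsFrom 0 N) (trans (length-bitsFrom 0 N) N≡n+n) ⟩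
      + evenFact n ℤ.* (ballot 0ℤ (bitsFrom 0 N) ℤ.* + oddFact (n ∸ #T (bitsFrom 0 N)))
    ≡⟨ cong₂ (λ a t → + evenFact n ℤ.* (a ℤ.* + oddFact (n ∸ t)))
             (ballot-bits N 0 0 kl window)
             (trans (#T-bits N 0 kl window) (VP.length-toList ks)) ⟩
      + evenFact n ℤ.* (numerators 0 kl ℤ.* + oddFact (n ∸ m))
    ∎
    where
    open ≡-Reasoning
    pattern≡bits : map special (allFin N) ≡ bitsFrom 0 N
    pattern≡bits = bitsFrom-tabulate N 0 (λ i → i) (λ i → refl)

module Factorials where
  open CrossoutCount using (oddFact; evenFact)
  open import Data.Nat using (_!)

  factorial-split : ∀ n → (n ℕ.+ n) ! ≡ evenFact n ℕ.* oddFact n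
  factorial-split zero    = refl
  factorial-split (suc n) =
    begin
      (suc n ℕ.+ suc n) !
    ≡⟨ cong (λ k → suc k !) (ℕP.+-suc n n) ⟩
      suc (suc (n ℕ.+ n)) ℕ.* (suc (n ℕ.+ n) ℕ.* (n ℕ.+ n) !)
    ≡⟨ cong (λ k → suc (suc (n ℕ.+ n)) ℕ.* (suc (n ℕ.+ n) ℕ.* k)) (factorial-split n) ⟩
      suc (suc (n ℕ.+ n)) ℕ.* (suc (n ℕ.+ n) ℕ.* (evenFact n ℕ.* oddFact n))
    ≡⟨ ring (suc (suc (n ℕ.+ n))) (suc (n ℕ.+ n)) (evenFact n) (oddFact n) ⟩
      evenFact (suc n) ℕ.* oddFact (suc n)
    ∎
    where
    open ≡-Reasoning
    ring : ∀ a b c d → a ℕ.* (b ℕ.* (c ℕ.* d)) ≡ (a ℕ.* c) ℕ.* (b ℕ.* d)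
    ring = ℕSolver.solve-∀

  -- the denominator 2n − 2(i+1) + 1 of the factor of the (i+1)-st special value
  denominator : ℕ → ℕ → ℕ
  denominator n i = suc (2 ℕ.* n ∸ 2 ℕ.* suc i)

  denominators : ℕ → ℕ → List ℕ → ℕ
  denominators n = foldrFrom (λ i _ r → denominator n i ℕ.* r) 1

  oddFact-split : ∀ n o kl → o ℕ.+ length kl ≤ n →
                  oddFact (n ∸ o) ≡ denominators n o kl ℕ.* oddFact (n ∸ (o ℕ.+ length kl))
  oddFact-split n o []       _  =
    trans (cong (λ k → oddFact (n ∸ k)) (sym (ℕP.+-identityʳ o))) (sym (ℕP.+-identityʳ _))
  oddFact-split n o (k ∷ kl) le =
    begin
      oddFact (n ∸ o)
    ≡⟨ cong oddFact (ℕP.+-∸-assoc 1 o<n) ⟩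
      suc (d ℕ.+ d) ℕ.* oddFact d
    ≡⟨ cong₂ ℕ._*_ (cong suc d+d) (oddFact-split n (suc o) kl (ℕP.≤-trans (ℕP.≤-reflexive (sym (ℕP.+-suc o _))) le)) ⟩
      denominator n o ℕ.* (denominators n (suc o) kl ℕ.* oddFact (n ∸ (suc o ℕ.+ length kl)))
    ≡⟨ sym (ℕP.*-assoc (denominator n o) (denominators n (suc o) kl) (oddFact (n ∸ (suc o ℕ.+ length kl)))) ⟩
      denominators n o (k ∷ kl) ℕ.* oddFact (n ∸ (suc o ℕ.+ length kl))
    ≡⟨ cong (λ j → denominators n o (k ∷ kl) ℕ.* oddFact (n ∸ j)) (sym (ℕP.+-suc o (length kl))) ⟩
      denominators n o (k ∷ kl) ℕ.* oddFact (n ∸ (o ℕ.+ length (k ∷ kl)))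
    ∎
    where
    open ≡-Reasoning
    o<n : suc o ≤ n
    o<n = ℕP.≤-trans (ℕP.≤-trans (ℕP.≤-reflexive (ℕP.+-comm 1 o)) (ℕP.+-monoʳ-≤ o (s≤s z≤n))) le
    d = n ∸ suc o
    d+d : d ℕ.+ d ≡ 2 ℕ.* n ∸ 2 ℕ.* suc o
    d+d = trans (cong (d ℕ.+_) (sym (ℕP.+-identityʳ d))) (ℕP.*-distribˡ-∸ 2 n (suc o))

foldr-enumeration : ∀ {A : Set} (f : ℕ → ℕ → A → A) e {m} (ks : Vec ℕ m)
                    {m′} (g : Fin m′ → Fin m) (ks′ : Vec ℕ m′) o →
                    (∀ j → lookup ks (g j) ≡ lookup ks′ j) → (∀ j → toℕ (g j) ≡ o ℕ.+ toℕ j) →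
                    foldr (λ j → f (toℕ j) (lookup ks j)) e (tabulate g) ≡ foldrFrom f e o (toList ks′)
foldr-enumeration f e ks g V.[]         o _   _   = refl
foldr-enumeration f e ks g (k′ V.∷ ks′) o ks≡ g≡ =
  trans (cong₂ (λ i k → f i k (foldr (λ j → f (toℕ j) (lookup ks j)) e (tabulate (g ∘ F.suc))))
               (trans (g≡ F.zero) (ℕP.+-identityʳ o)) (ks≡ F.zero))
        (cong (f o k′) (foldr-enumeration f e ks (g ∘ F.suc) ks′ (suc o) (ks≡ ∘ F.suc)
                                          (λ j → trans (g≡ (F.suc j)) (ℕP.+-suc o (toℕ j)))))

foldr-allFin : ∀ {A : Set} (f : ℕ → ℕ → A → A) e {m} (ks : Vec ℕ m) →
               foldr (λ j → f (toℕ j) (lookup ks j)) e (allFin m) ≡ foldrFrom f e 0 (toList ks)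
foldr-allFin f e ks = foldr-enumeration f e ks (λ j → j) ks 0 (λ _ → refl) (λ _ → refl)

module Fractions where
  open import Data.Rational as ℚ using (1ℚ; _/_)
  import Data.Rational.Properties as ℚP
  open import Data.Rational.Unnormalised as ℚᵘ using (mkℚᵘ)
  import Data.Rational.Unnormalised.Properties as ℚᵘP

  -- the denominator, minus one, of the unnormalised product of the a j / (1 + b j)
  predProduct : ∀ {J : Set} → (J → ℕ) → List J → ℕ
  predProduct b []       = 0
  predProduct b (j ∷ js) = predProduct b js ℕ.+ b j ℕ.* suc (predProduct b js)

  suc-predProduct : ∀ {J : Set} (b : J → ℕ) js → suc (predProduct b js) ≡ foldr (λ j r → suc (b j) ℕ.* r) 1 js
  suc-predProduct b []       = refl
  suc-predProduct b (j ∷ js) = cong (λ d → d ℕ.+ b j ℕ.* d) (suc-predProduct b js)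

  toℚᵘ-/ : ∀ p q → ℚ.toℚᵘ (p / suc q) ℚᵘ.≃ mkℚᵘ p q
  toℚᵘ-/ p q = ℚP.toℚᵘ-fromℚᵘ (mkℚᵘ p q)

  toℚᵘ-∏ : ∀ {J : Set} (a : J → ℤ) (b : J → ℕ) js →
           ℚ.toℚᵘ (foldr (λ j r → (a j / suc (b j)) ℚ.* r) 1ℚ js)
             ℚᵘ.≃ mkℚᵘ (foldr (λ j r → a j ℤ.* r) 1ℤ js) (predProduct b js)
  toℚᵘ-∏ a b []       = ℚᵘP.≃-refl
  toℚᵘ-∏ a b (j ∷ js) =
    ℚᵘP.≃-trans (ℚP.toℚᵘ-homo-* (a j / suc (b j)) _)
                (ℚᵘP.*-cong (toℚᵘ-/ (a j) (b j)) (toℚᵘ-∏ a b js))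

module Probability (n m : ℕ) (ks : Vec ℕ m)
                   (k≥1 : ∀ (j : Fin m) → 1 ≤ lookup ks j)
                   (k≤2n : ∀ (j : Fin m) → lookup ks j ≤ 2 ℕ.* n)
                   (increasing : ∀ (i j : Fin m) → i F.< j → lookup ks i < lookup ks j)
                   (m≤n : m ≤ n) where
  open import Defs using (prob; productFormula)
  open import Data.Nat using (_!)
  import Data.Rational as ℚ
  import Data.Rational.Properties as ℚP
  open import Data.Rational.Unnormalised as ℚᵘ using (mkℚᵘ; *≡*)
  import Data.Rational.Unnormalised.Properties as ℚᵘP
  open Favourable n m ks k≥1 k≤2n increasing using (favourable; favourable-closed; kl)
  open CrossoutCount using (oddFact; evenFact)
  open Factorials
  open Fractions

  F : ℕ
  F = (2 ℕ.* n) !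
  instance _ = (2 ℕ.* n) ℕP.!≢0

  numer : Fin m → ℤ
  numer j = numerator (toℕ j) (lookup ks j)
  denom : Fin m → ℕ
  denom j = 2 ℕ.* n ∸ 2 ℕ.* suc (toℕ j)

  prob≃ : ℚ.toℚᵘ (prob n ks) ℚᵘ.≃ mkℚᵘ (+ favourable) (ℕ.pred F)
  prob≃ = ℚᵘP.≃-trans (ℚᵘP.≃-reflexive (cong ℚ.toℚᵘ (ℚP./-cong {p₁ = + favourable} {q₁ = F} {p₂ = + favourable} {q₂ = suc (ℕ.pred F)} refl (sym (ℕP.suc-pred F)))))
                      (toℚᵘ-/ (+ favourable) (ℕ.pred F))

  product≃ : ℚ.toℚᵘ (productFormula n ks) ℚᵘ.≃ mkℚᵘ (numerators 0 kl) (predProduct denom (allFin m))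
  product≃ = ℚᵘP.≃-trans (toℚᵘ-∏ numer denom (allFin m))
               (ℚᵘP.≃-reflexive (cong (λ a → mkℚᵘ a (predProduct denom (allFin m))) (foldr-allFin (λ i k r → numerator i k ℤ.* r) 1ℤ ks)))

  denominators≡ : suc (predProduct denom (allFin m)) ≡ denominators n 0 kl
  denominators≡ = trans (suc-predProduct denom (allFin m)) (foldr-allFin (λ i _ r → denominator n i ℕ.* r) 1 ks)

  F≡ : F ≡ evenFact n ℕ.* (denominators n 0 kl ℕ.* oddFact (n ∸ m))
  F≡ = trans (cong _! (cong (n ℕ.+_) (ℕP.+-identityʳ n)))
         (trans (factorial-split n)
                (cong (evenFact n ℕ.*_)
                      (trans (oddFact-split n 0 kl (subst (_≤ n) (sym (VP.length-toList ks)) m≤n))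
                             (cong (λ k → denominators n 0 kl ℕ.* oddFact (n ∸ k)) (VP.length-toList ks)))))

  cross-multiplied : mkℚᵘ (+ favourable) (ℕ.pred F) ℚᵘ.≃ mkℚᵘ (numerators 0 kl) (predProduct denom (allFin m))
  cross-multiplied = *≡* (begin
      + favourable ℤ.* + suc (predProduct denom (allFin m))
    ≡⟨ cong₂ ℤ._*_ favourable-closed (cong +_ denominators≡) ⟩
      (+ E ℤ.* (numerators 0 kl ℤ.* + O)) ℤ.* + D
    ≡⟨ ring (+ E) (numerators 0 kl) (+ O) (+ D) ⟩
      numerators 0 kl ℤ.* (+ E ℤ.* (+ D ℤ.* + O))
    ≡⟨ cong (numerators 0 kl ℤ.*_) (trans (cong (+ E ℤ.*_) (sym (ℤP.pos-* D O))) (sym (ℤP.pos-* E (D ℕ.* O)))) ⟩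
      numerators 0 kl ℤ.* + (E ℕ.* (D ℕ.* O))
    ≡⟨ cong (λ k → numerators 0 kl ℤ.* + k) (sym (trans (ℕP.suc-pred F) F≡)) ⟩
      numerators 0 kl ℤ.* + suc (ℕ.pred F)
    ∎)
    where
    open ≡-Reasoning
    E = evenFact n
    D = denominators n 0 kl
    O = oddFact (n ∸ m)
    ring : ∀ e q o d → (e ℤ.* (q ℤ.* o)) ℤ.* d ≡ q ℤ.* (e ℤ.* (d ℤ.* o))
    ring = ℤSolver.solve-∀

  prob≡productFormula : prob n ks ≡ productFormula n ks
  prob≡productFormula =
    ℚP.toℚᵘ-injective (ℚᵘP.≃-trans prob≃ (ℚᵘP.≃-trans cross-multiplied (ℚᵘP.≃-sym product≃)))

open import Defs using (prob; productFormula)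
open import Data.Nat using (_*_)
import Data.Fin

theorem9 : (n m : ℕ) → 1 ≤ n → 1 ≤ m → m ≤ n →
    (ks : Vec ℕ m) →
    (∀ (j : Fin m) → 1 ≤ lookup ks j) →
    (∀ (j : Fin m) → lookup ks j ≤ 2 * n) →
    (∀ (i j : Fin m) → i Data.Fin.< j → lookup ks i < lookup ks j) →
    prob n ks ≡ productFormula n ks
theorem9 n m _ _ m≤n ks k≥1 k≤2n increasing =
  Probability.prob≡productFormula n m ks k≥1 k≤2n increasing m≤n
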